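{- Let $q=p^k$ ($p$ prime, $k\in\mathbb{N}$) and $n=m\,p^i$ with $i\ge0$, $\gcd(m,p)=1$ and $m\nmid q-1$. Let $e$ be the multiplicative order of $q$ modulo $m$ and assume $e>2$. Let $g$ be the product of all distinct monic irreducible factors of $x^m-1$ over $\mathbb{F}_q$ of degree less than $e$, let $g_1,\dots,g_t$ be the remaining distinct monic irreducible factors of $x^n-1$ over $\mathbb{F}_q$ (those not dividing $g$), and set $$\mathcal{D}=1-2\sum_{i=1}^{t}\frac{1}{q^{\deg g_i}},\qquad \mathcal{S}=\frac{2t-1}{\mathcal{D}}+2.$$ Then $\mathcal{D}>0$ and $\mathcal{S}\le 2m$.
   Context: These quantities are the ones in the sieving criterion with the choice $d=q^n-1$ (so that no primes dividing $q^n-1$ remain outside $d$). -}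

module Defs where

open import Level using (0ℓ)
open import Algebra.Bundles using (CommutativeRing)
open import Data.Nat as ℕ using (ℕ; zero; suc; _∸_; _^_; _<_)
open import Data.Nat.Divisibility using (_∣_)
open import Data.Integer using (+_)
open import Data.Rational as ℚ using (ℚ; 0ℚ; 1ℚ; _÷_; _/_; >-nonZero)
open import Data.List using (List; []; _∷_; [_]; map; foldr; replicate; _++_)
open import Data.List.Relation.Unary.All using (All)
open import Data.List.Relation.Unary.Any using (Any)
open import Data.List.Relation.Unary.AllPairs using (AllPairs)
open import Data.Vec using (Vec; toList)
open import Data.Fin using (Fin)
open import Data.Product using (Σ; _×_; proj₁; _,_)
open import Data.Sum using (_⊎_)
open import Relation.Nullary using (¬_)
open import Relation.Binary.PropositionalEquality using (_≡_)

IsMulOrder : ℕ → ℕ → ℕ → Set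
IsMulOrder q m e =
  (0 < e) × (m ∣ (q ^ e ∸ 1)) × (∀ j → 0 < j → j < e → ¬ (m ∣ (q ^ j ∸ 1)))

ℕtoℚ : ℕ → ℚ
ℕtoℚ n = + n / 1

-- 1/n  (convention: 1/0 = 0; only ever applied to q^d with q ≥ 2)
recip : ℕ → ℚ
recip zero = 0ℚ
recip (suc n) = + 1 / suc n

sumℚ : List ℚ → ℚ
sumℚ = foldr ℚ._+_ 0ℚ

𝒟 : ℕ → List ℕ → ℚ
𝒟 q ds = 1ℚ ℚ.- ℕtoℚ 2 ℚ.* sumℚ (map (λ d → recip (q ^ d)) ds)

𝒮 : (t : ℕ) (D : ℚ) → 0ℚ ℚ.< D → ℚ
𝒮 t D h = _÷_ (ℕtoℚ (2 ℕ.* t) ℚ.- 1ℚ) D {{>-nonZero h}} ℚ.+ ℕtoℚ 2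

module Poly (R : CommutativeRing 0ℓ 0ℓ) where
  open CommutativeRing R renaming (Carrier to A)

  IsField : Set
  IsField = (¬ (1# ≈ 0#)) × (∀ x → ¬ (x ≈ 0#) → Σ A λ y → (x * y) ≈ 1#)

  HasSize : ℕ → Set
  HasSize q = Σ (Fin q → A) λ enum →
    (∀ i j → enum i ≈ enum j → i ≡ j) × (∀ x → Σ (Fin q) λ i → enum i ≈ x)

  -- polynomials as coefficient lists, lowest degree first
  Pol : Set
  Pol = List A

  coeff : Pol → ℕ → A
  coeff [] i = 0#
  coeff (a ∷ f) zero = a
  coeff (a ∷ f) (suc i) = coeff f i

  infix 4 _≈ₚ_
  _≈ₚ_ : Pol → Pol → Set
  f ≈ₚ g = ∀ i → coeff f i ≈ coeff g i

  infixl 6 _+ₚ_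
  _+ₚ_ : Pol → Pol → Pol
  [] +ₚ g = g
  (a ∷ f) +ₚ [] = a ∷ f
  (a ∷ f) +ₚ (b ∷ g) = (a + b) ∷ (f +ₚ g)

  infixl 7 _*ₚ_
  _*ₚ_ : Pol → Pol → Pol
  [] *ₚ g = []
  (a ∷ f) *ₚ g = map (a *_) g +ₚ (0# ∷ (f *ₚ g))

  infix 4 _∣ₚ_
  _∣ₚ_ : Pol → Pol → Set
  f ∣ₚ h = Σ Pol λ r → (f *ₚ r) ≈ₚ h

  IsUnit : Pol → Set
  IsUnit f = Σ Pol λ u → (f *ₚ u) ≈ₚ [ 1# ]

  IsIrreducible : Pol → Set
  IsIrreducible f = (¬ (f ≈ₚ [])) × (¬ IsUnit f) ×
    (∀ g h → (g *ₚ h) ≈ₚ f → IsUnit g ⊎ IsUnit h)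

  -- a monic polynomial of degree d: its d lower coefficients (leading coeff 1)
  Monic : Set
  Monic = Σ ℕ (Vec A)

  deg : Monic → ℕ
  deg = proj₁

  toPol : Monic → Pol
  toPol (d , v) = toList v ++ [ 1# ]

  xⁿ-1 : ℕ → Pol
  xⁿ-1 n = [ - 1# ] +ₚ (replicate n 0# ++ [ 1# ])

  prodₚ : List Monic → Pol
  prodₚ = foldr (λ f acc → toPol f *ₚ acc) [ 1# ]

  MonicIrredFactor : Pol → Monic → Set
  MonicIrredFactor h f = IsIrreducible (toPol f) × (toPol f ∣ₚ h)

  Enumerates : (Monic → Set) → List Monic → Set
  Enumerates P L = All P L ×
    AllPairs (λ f g → ¬ (toPol f ≈ₚ toPol g)) L ×
    (∀ f → P f → Any (λ g → toPol f ≈ₚ toPol g) L)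

-- Over 𝔽_q, q = pᵏ, the field has characteristic p and Frobenius gives x^(m pⁱ) − 1 = (x^m − 1)^(pⁱ),
-- so every irreducible factor gⱼ of x^(m pⁱ) − 1 divides x^m − 1. The gⱼ are distinct, so their product
-- divides x^m − 1 and Σ deg gⱼ ≤ m; a gⱼ of degree < e would divide g, so every deg gⱼ ≥ e ≥ 3 and
-- 3t ≤ m. As m ∣ q^e − 1, Q := q^e > m and Σ q^(−deg gⱼ) ≤ t / Q. Hence 𝒟 ≥ 1 − 2t / Q > 0, and
-- 𝒮 ≤ 2m reduces to (2t − 1) Q ≤ (2m − 2)(Q − 2t), a polynomial inequality in t, m and Q.

module Submission where

open import Defs
open import Level using (0ℓ)
open import Algebra.Bundles using (CommutativeRing)
open import Data.Nat.Base using (ℕ)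
open import Relation.Binary.Definitions using (Decidable)

module NaturalNumberFacts where
  open import Data.Nat.Base using (zero; suc; _+_; _*_; _^_; _∸_; _≤_; _<_; s≤s; z≤n; >-nonZero; nonTrivial⇒n>1)
  open import Data.Nat.Properties
    using (≤-trans; ≤-reflexive; m≤m+n; ^-monoʳ-≤; *-identityʳ; *-suc; +-mono-≤; m≤n⇒∃[o]m+o≡n)
  open import Data.Nat.Tactic.RingSolver using (solve-∀)
  open import Data.Nat.Divisibility using (_∣_; ∣⇒≤; _∣0)
  open import Data.Nat.Primality using (Prime; prime⇒nonTrivial)
  open import Data.Nat.Coprimality using (Coprime; ¬0-coprimeTo-2+)
  open import Relation.Nullary using (¬_; contradiction)
  open import Data.Empty using (⊥-elim)
  open import Data.Nat.ListAction using (sum)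
  open import Data.List.Base using (List; []; _∷_; length)
  open import Data.List.Relation.Unary.All using (All; []; _∷_)
  open import Data.Product.Base using (_,_)
  open import Relation.Binary.PropositionalEquality using (_≡_; refl; sym; subst)

  2≤a^n : ∀ {a n} → 2 ≤ a → 1 ≤ n → 2 ≤ a ^ n
  2≤a^n {a} {n} 2≤a 1≤n = ≤-trans 2≤a
    (subst (_≤ a ^ n) (*-identityʳ a) (^-monoʳ-≤ a {{>-nonZero (≤-trans (s≤s z≤n) 2≤a)}} 1≤n))

  ∣n∸1⇒< : ∀ {m n} → 2 ≤ n → m ∣ n ∸ 1 → m < n
  ∣n∸1⇒< {n = suc zero}    (s≤s ()) _
  ∣n∸1⇒< {n = suc (suc n)} _        m∣1+n = s≤s (∣⇒≤ m∣1+n)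

  coprimeTo-prime⇒>0 : ∀ {m p} → Prime p → Coprime m p → 0 < m
  coprimeTo-prime⇒>0 {zero}  p-prime 0⊥p = ⊥-elim (¬0-coprimeTo-2+ {{prime⇒nonTrivial p-prime}} 0⊥p)
  coprimeTo-prime⇒>0 {suc m} _       _   = s≤s z≤n

  ∤pᵏ∸1⇒2≤pᵏ : ∀ {p k m} → Prime p → ¬ m ∣ p ^ k ∸ 1 → 2 ≤ p ^ k
  ∤pᵏ∸1⇒2≤pᵏ {p} {zero}  {m} _       m∤0 = contradiction (m ∣0) m∤0
  ∤pᵏ∸1⇒2≤pᵏ {p} {suc k}     p-prime _   =
    2≤a^n {p} {suc k} (nonTrivial⇒n>1 p {{prime⇒nonTrivial p-prime}}) (s≤s z≤n)

  3*length≤sum : ∀ {e} ds → 2 < e → All (e ≤_) ds → 3 * length ds ≤ sum ds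
  3*length≤sum []       _   []           = z≤n
  3*length≤sum (d ∷ ds) 2<e (e≤d ∷ e≤ds) =
    subst (_≤ d + sum ds) (sym (*-suc 3 (length ds))) (+-mono-≤ (≤-trans 2<e e≤d) (3*length≤sum ds 2<e e≤ds))

  private
    slack-identity₁ : ∀ t b a →
      2 * suc t * (suc (3 * suc t + b) + a) + (suc (3 * suc t + b) + a) + 4 * (3 * suc t + b) * suc t
        + (a * (4 * t + 2 * b + 3) + 6 * t * b + 7 * b + 2 * b * b + 5 * t + 4)
      ≡ 2 * (3 * suc t + b) * (suc (3 * suc t + b) + a) + 4 * suc t
    slack-identity₁ = solve-∀

    slack-identity₂ : ∀ b a →
      2 * 0 * (suc (suc b) + a) + (suc (suc b) + a) + 4 * suc b * 0
        + (a * (2 * b + 1) + 2 * b * b + 5 * b + 2)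
      ≡ 2 * suc b * (suc (suc b) + a) + 4 * 0
    slack-identity₂ = solve-∀

  -- (2t − 1) Q ≤ (2m − 2)(Q − 2t), with the subtractions moved across; write m = 3t + b and Q = m + 1 + a.
  cross-multiplied-bound : ∀ {t m Q} → 1 ≤ m → 3 * t ≤ m → m < Q →
    2 * t * Q + Q + 4 * m * t ≤ 2 * m * Q + 4 * t
  cross-multiplied-bound {t} 1≤m 3t≤m m<Q with m≤n⇒∃[o]m+o≡n 3t≤m | m≤n⇒∃[o]m+o≡n m<Q
  cross-multiplied-bound {suc t} _ _ _ | (b , refl) | (a , refl) =
    ≤-trans (m≤m+n _ _) (≤-reflexive (slack-identity₁ t b a))
  cross-multiplied-bound {zero} () _ _ | (zero , refl) | _
  cross-multiplied-bound {zero} _ _ _ | (suc b , refl) | (a , refl) =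
    ≤-trans (m≤m+n _ _) (≤-reflexive (slack-identity₂ b a))

module BinomialCoefficients where
  open import Data.Nat.Base using (zero; suc; _+_; _*_; _<_; s≤s; z≤n)
  open import Data.Nat.Properties using (*-zeroʳ; *-identityˡ; *-identityʳ; *-distribˡ-+; *-comm; +-assoc; <⇒≱)
  open import Data.Nat.Combinatorics using (_C_; nC1≡n; nCk+nC[k+1]≡[n+1]C[k+1]; k>n⇒nCk≡0)
  open import Data.Nat.Divisibility using (_∣_; divides; ∣⇒≤)
  open import Data.Nat.Primality using (Prime; euclidsLemma)
  open import Data.Sum.Base using (inj₁; inj₂)
  open import Relation.Nullary using (contradiction)
  open import Relation.Binary.PropositionalEquality using (_≡_; refl; trans; cong; cong₂; module ≡-Reasoning)

  [k+1]*[n+1]C[k+1]≡[n+1]*nCk : ∀ n k → suc k * (suc n C suc k) ≡ suc n * (n C k)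
  [k+1]*[n+1]C[k+1]≡[n+1]*nCk zero    zero    = refl
  [k+1]*[n+1]C[k+1]≡[n+1]*nCk zero    (suc k) = begin
    suc (suc k) * (1 C suc (suc k)) ≡⟨ cong (suc (suc k) *_) (k>n⇒nCk≡0 {1} {suc (suc k)} (s≤s (s≤s z≤n))) ⟩
    suc (suc k) * 0                 ≡⟨ *-zeroʳ (suc (suc k)) ⟩
    0                               ≡⟨ cong (1 *_) (k>n⇒nCk≡0 {0} {suc k} (s≤s z≤n)) ⟨
    1 * (0 C suc k)                 ∎
    where open ≡-Reasoning
  [k+1]*[n+1]C[k+1]≡[n+1]*nCk (suc n) zero    = begin
    1 * (suc (suc n) C 1) ≡⟨ *-identityˡ _ ⟩
    suc (suc n) C 1       ≡⟨ nC1≡n (suc (suc n)) ⟩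
    suc (suc n)           ≡⟨ *-identityʳ _ ⟨
    suc (suc n) * 1       ∎
    where open ≡-Reasoning
  [k+1]*[n+1]C[k+1]≡[n+1]*nCk (suc n) (suc k) = begin
    suc (suc k) * (suc (suc n) C suc (suc k))
      ≡⟨ cong (suc (suc k) *_) (nCk+nC[k+1]≡[n+1]C[k+1] (suc n) (suc k)) ⟨
    suc (suc k) * (a + b)
      ≡⟨ *-distribˡ-+ (suc (suc k)) a b ⟩
    (a + suc k * a) + suc (suc k) * b
      ≡⟨ cong₂ (λ u v → (a + u) + v) ([k+1]*[n+1]C[k+1]≡[n+1]*nCk n k) ([k+1]*[n+1]C[k+1]≡[n+1]*nCk n (suc k)) ⟩
    (a + suc n * (n C k)) + suc n * (n C suc k)
      ≡⟨ +-assoc a _ _ ⟩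
    a + (suc n * (n C k) + suc n * (n C suc k))
      ≡⟨ cong (a +_) (*-distribˡ-+ (suc n) (n C k) (n C suc k)) ⟨
    a + suc n * (n C k + n C suc k)
      ≡⟨ cong (λ c → a + suc n * c) (nCk+nC[k+1]≡[n+1]C[k+1] n k) ⟩
    a + suc n * a ∎
    where
    open ≡-Reasoning
    a = suc n C suc k
    b = suc n C suc (suc k)

  -- k · (p C k) = p · ((p ∸ 1) C (k ∸ 1)) and p ∤ k.
  p∣pCk : ∀ {p k} → Prime p → 0 < k → k < p → p ∣ p C k
  p∣pCk {suc p} {suc k} p-prime (s≤s z≤n) (s≤s k<p)
    with euclidsLemma (suc k) (suc p C suc k) p-prime
           (divides (p C k) (trans ([k+1]*[n+1]C[k+1]≡[n+1]*nCk p k) (*-comm (suc p) (p C k))))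
  ... | inj₁ p∣1+k = contradiction (∣⇒≤ p∣1+k) (<⇒≱ (s≤s k<p))
  ... | inj₂ p∣pCk = p∣pCk

module Frobenius {c ℓ} (R : CommutativeRing c ℓ) where
  open import Data.Nat.Base as ℕ using (ℕ; zero; suc; _∸_; s≤s; z≤n)
  open import Data.Nat.Properties using (n∸n≡0)
  open import Data.Nat.Combinatorics using (_C_; nCn≡1)
  open import Data.Nat.Divisibility using (_∣_; divides)
  open import Data.Nat.Primality using (Prime)
  open import Data.Fin.Base as Fin using (toℕ; fromℕ)
  open import Data.Fin.Properties using (toℕ-fromℕ; toℕ-inject₁; toℕ<n)
  open import Data.Vec.Functional using (Vector; tail; init; last)
  import Relation.Binary.PropositionalEquality as ≡
  open CommutativeRing R
  open import Algebra.Properties.Semiring.Exp semiring using (_^_; ^-congˡ)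
  open import Algebra.Properties.Group +-group using (inverseʳ-unique)
  open import Algebra.Properties.Semiring.Mult semiring using (_×_; ×-congʳ; ×-homo-1; ×-assoc-*; ×1-homo-*)
  open import Algebra.Properties.Monoid.Sum +-monoid using (sum; sum-cong-≋; sum-replicate-zero; sum-init-last)
  import Algebra.Properties.CommutativeSemiring.Binomial commutativeSemiring as Binomial
  open import Relation.Binary.Reasoning.Setoid setoid
  open BinomialCoefficients using (p∣pCk)

  ∣⇒×≈0 : ∀ {p n} → p × 1# ≈ 0# → p ∣ n → ∀ x → n × x ≈ 0#
  ∣⇒×≈0 {p} char (divides r ≡.refl) x = begin
    (r ℕ.* p) × x               ≈⟨ ×-congʳ (r ℕ.* p) (*-identityˡ x) ⟨
    (r ℕ.* p) × (1# * x)        ≈⟨ ×-assoc-* (r ℕ.* p) 1# x ⟨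
    ((r ℕ.* p) × 1#) * x        ≈⟨ *-congʳ (×1-homo-* r p) ⟩
    ((r × 1#) * (p × 1#)) * x   ≈⟨ *-congʳ (*-congˡ char) ⟩
    ((r × 1#) * 0#) * x         ≈⟨ *-congʳ (zeroʳ _) ⟩
    0# * x                      ≈⟨ zeroˡ x ⟩
    0#                          ∎

  frobenius : ∀ {p} → Prime p → p × 1# ≈ 0# → ∀ x y → (x + y) ^ p ≈ x ^ p + y ^ p
  frobenius {suc n} p-prime char x y = begin
    (x + y) ^ suc n                                   ≈⟨ Binomial.theorem (suc n) x y ⟩
    T Fin.zero + sum (tail T)                         ≈⟨ +-congˡ (sum-init-last (tail T)) ⟩
    T Fin.zero + (sum (init (tail T)) + last (tail T)) ≈⟨ +-cong first-term (+-cong middle-terms last-term) ⟩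
    y ^ suc n + (0# + x ^ suc n)                      ≈⟨ +-congˡ (+-identityˡ _) ⟩
    y ^ suc n + x ^ suc n                             ≈⟨ +-comm _ _ ⟩
    x ^ suc n + y ^ suc n                             ∎
    where
    T : Vector Carrier (suc (suc n))
    T = Binomial.binomialTerm x y (suc n)

    first-term : T Fin.zero ≈ y ^ suc n
    first-term = trans (+-identityʳ _) (*-identityˡ _)

    middle-terms : sum (init (tail T)) ≈ 0#
    middle-terms = trans (sum-cong-≋ λ i → ∣⇒×≈0 char (p∣pCk p-prime (s≤s z≤n)
                           (s≤s (≡.subst (ℕ._< n) (≡.sym (toℕ-inject₁ i)) (toℕ<n i)))) _)
                         (sum-replicate-zero n)

    last-term : last (tail T) ≈ x ^ suc n
    last-term = begin
      (suc n C toℕ (Fin.suc (fromℕ n))) × (x ^ toℕ (Fin.suc (fromℕ n)) * y ^ (suc n ∸ toℕ (Fin.suc (fromℕ n))))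
        ≡⟨ ≡.cong (λ k → (suc n C k) × (x ^ k * y ^ (suc n ∸ k))) (≡.cong suc (toℕ-fromℕ n)) ⟩
      (suc n C suc n) × (x ^ suc n * y ^ (suc n ∸ suc n))
        ≡⟨ ≡.cong₂ (λ a b → a × (x ^ suc n * y ^ b)) (nCn≡1 (suc n)) (n∸n≡0 (suc n)) ⟩
      1 × (x ^ suc n * 1#)  ≈⟨ ×-homo-1 _ ⟩
      x ^ suc n * 1#        ≈⟨ *-identityʳ _ ⟩
      x ^ suc n             ∎

  1#^n≈1# : ∀ n → 1# ^ n ≈ 1#
  1#^n≈1# zero    = refl
  1#^n≈1# (suc n) = trans (*-identityˡ _) (1#^n≈1# n)

  -1#^p≈-1# : ∀ {p} → Prime p → p × 1# ≈ 0# → (- 1#) ^ p ≈ - 1#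
  -1#^p≈-1# {suc n} p-prime char = inverseʳ-unique 1# ((- 1#) ^ suc n) (begin
    1# + (- 1#) ^ suc n           ≈⟨ +-congʳ (1#^n≈1# (suc n)) ⟨
    1# ^ suc n + (- 1#) ^ suc n   ≈⟨ frobenius p-prime char 1# (- 1#) ⟨
    (1# - 1#) ^ suc n             ≈⟨ ^-congˡ (suc n) (-‿inverseʳ 1#) ⟩
    0# ^ suc n                    ≈⟨ zeroˡ _ ⟩
    0#                            ∎)

module FiniteCommutativeRing (F : CommutativeRing 0ℓ 0ℓ) {q : ℕ} (size : Poly.HasSize F q) where
  open import Data.Fin.Base using (Fin)
  import Data.Fin.Properties as Fin
  open import Data.Fin.Permutation using (permutation)
  open import Data.Product.Base using (proj₁; proj₂)
  open import Relation.Binary.PropositionalEquality as ≡ using (_≡_; subst)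
  open import Relation.Nullary using (yes; no)
  open CommutativeRing F renaming (Carrier to A)
  open import Algebra.Properties.CommutativeMonoid.Sum +-commutativeMonoid
    using (sum; sum-cong-≋; sum-permute; ∑-distrib-+; sum-replicate)
  open import Algebra.Properties.Group +-group using (identityʳ-unique)
  open import Algebra.Properties.Semiring.Mult semiring using (_×_)
  open import Relation.Binary.Reasoning.Setoid setoid

  private
    enum : Fin q → A
    enum = proj₁ size

    index : A → Fin q
    index x = proj₁ (proj₂ (proj₂ size) x)

    enum-index : ∀ x → enum (index x) ≈ x
    enum-index x = proj₂ (proj₂ (proj₂ size) x)

    index-cong : ∀ {x y} → x ≈ y → index x ≡ index y
    index-cong {x} {y} x≈y = proj₁ (proj₂ size) _ _ (trans (enum-index x) (trans x≈y (sym (enum-index y))))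

    index-enum : ∀ i → index (enum i) ≡ i
    index-enum i = proj₁ (proj₂ size) _ _ (enum-index (enum i))

  _≟_ : Decidable _≈_
  x ≟ y with index x Fin.≟ index y
  ... | yes ix≡iy = yes (trans (sym (enum-index x)) (subst (λ i → enum i ≈ y) (≡.sym ix≡iy) (enum-index y)))
  ... | no  ix≢iy = no λ x≈y → ix≢iy (index-cong x≈y)

  -- Translation by 1# permutes the q elements, so it leaves their sum S unchanged: S ≈ S + q × 1#.
  size×1#≈0# : q × 1# ≈ 0#
  size×1#≈0# = identityʳ-unique S (q × 1#) (sym S≈S+q×1#)
    where
    shift : Fin q → Fin q
    shift i = index (enum i + 1#)

    unshift : Fin q → Fin q
    unshift i = index (enum i - 1#)

    cancel : ∀ i {a b} → a + b ≈ 0# → index (enum (index (enum i + b)) + a) ≡ i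
    cancel i {a} {b} a+b≈0 = ≡.trans (index-cong (begin
      enum (index (enum i + b)) + a ≈⟨ +-congʳ (enum-index _) ⟩
      (enum i + b) + a              ≈⟨ +-assoc _ _ _ ⟩
      enum i + (b + a)              ≈⟨ +-congˡ (trans (+-comm b a) a+b≈0) ⟩
      enum i + 0#                   ≈⟨ +-identityʳ _ ⟩
      enum i                        ∎)) (index-enum i)

    S : A
    S = sum enum

    S≈S+q×1# : S ≈ S + q × 1#
    S≈S+q×1# = begin
      S                                 ≈⟨ sum-permute enum (permutation shift unshift
                                             (λ i → cancel i (-‿inverseʳ 1#)) (λ i → cancel i (-‿inverseˡ 1#))) ⟩
      sum (λ i → enum (shift i))        ≈⟨ sum-cong-≋ (λ i → enum-index (enum i + 1#)) ⟩
      sum (λ i → enum i + 1#)           ≈⟨ ∑-distrib-+ enum (λ _ → 1#) ⟩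
      S + sum {q} (λ _ → 1#)            ≈⟨ +-congˡ (sum-replicate q) ⟩
      S + q × 1#                        ∎

module FieldProperties (F : CommutativeRing 0ℓ 0ℓ) (isField : Poly.IsField F) where
  open import Data.Product.Base using (proj₁; proj₂)
  open import Relation.Nullary using (¬_)
  open CommutativeRing F renaming (Carrier to A)
  open import Relation.Binary.Reasoning.Setoid setoid

  1#≉0# : ¬ 1# ≈ 0#
  1#≉0# = proj₁ isField

  _⁻¹[_] : ∀ x → ¬ x ≈ 0# → A
  x ⁻¹[ x≉0 ] = proj₁ (proj₂ isField x x≉0)

  *-inverseʳ : ∀ x (x≉0 : ¬ x ≈ 0#) → x * x ⁻¹[ x≉0 ] ≈ 1#
  *-inverseʳ x x≉0 = proj₂ (proj₂ isField x x≉0)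

  *-inverseˡ : ∀ x (x≉0 : ¬ x ≈ 0#) → x ⁻¹[ x≉0 ] * x ≈ 1#
  *-inverseˡ x x≉0 = trans (*-comm _ _) (*-inverseʳ x x≉0)

  x⁻¹*[x*y]≈y : ∀ x (x≉0 : ¬ x ≈ 0#) y → x ⁻¹[ x≉0 ] * (x * y) ≈ y
  x⁻¹*[x*y]≈y x x≉0 y = begin
    x ⁻¹[ x≉0 ] * (x * y)   ≈⟨ *-assoc _ _ _ ⟨
    (x ⁻¹[ x≉0 ] * x) * y   ≈⟨ *-congʳ (*-inverseˡ x x≉0) ⟩
    1# * y                  ≈⟨ *-identityˡ y ⟩
    y                       ∎

  x*[x⁻¹*y]≈y : ∀ x (x≉0 : ¬ x ≈ 0#) y → x * (x ⁻¹[ x≉0 ] * y) ≈ y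
  x*[x⁻¹*y]≈y x x≉0 y = begin
    x * (x ⁻¹[ x≉0 ] * y)   ≈⟨ *-assoc _ _ _ ⟨
    (x * x ⁻¹[ x≉0 ]) * y   ≈⟨ *-congʳ (*-inverseʳ x x≉0) ⟩
    1# * y                  ≈⟨ *-identityˡ y ⟩
    y                       ∎

  x*y≈0⇒y≈0 : ∀ {x y} → ¬ x ≈ 0# → x * y ≈ 0# → y ≈ 0#
  x*y≈0⇒y≈0 {x} {y} x≉0 xy≈0 = begin
    y                       ≈⟨ x⁻¹*[x*y]≈y x x≉0 y ⟨
    x ⁻¹[ x≉0 ] * (x * y)   ≈⟨ *-congˡ xy≈0 ⟩
    x ⁻¹[ x≉0 ] * 0#        ≈⟨ zeroʳ _ ⟩
    0#                      ∎

  *-≉0 : ∀ {x y} → ¬ x ≈ 0# → ¬ y ≈ 0# → ¬ x * y ≈ 0#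
  *-≉0 x≉0 y≉0 xy≈0 = y≉0 (x*y≈0⇒y≈0 x≉0 xy≈0)

module FiniteField (F : CommutativeRing 0ℓ 0ℓ) (isField : Poly.IsField F) {q : ℕ} (size : Poly.HasSize F q) where
  open import Data.Nat.Base as ℕ using (zero; suc)
  open import Relation.Binary.PropositionalEquality using (_≡_; subst)
  open import Relation.Nullary using (yes; no; contradiction)
  open CommutativeRing F
  open import Algebra.Properties.Semiring.Mult semiring using (_×_; ×1-homo-*)
  open import Algebra.Properties.Semiring.Exp semiring using (_^_)
  open FieldProperties F isField using (1#≉0#; x*y≈0⇒y≈0)
  open FiniteCommutativeRing F size using (_≟_; size×1#≈0#)

  ^≈0⇒≈0 : ∀ x k → x ^ k ≈ 0# → x ≈ 0#
  ^≈0⇒≈0 x zero    1≈0  = contradiction 1≈0 1#≉0#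
  ^≈0⇒≈0 x (suc k) xᵏ⁺¹≈0 with x ≟ 0#
  ... | yes x≈0 = x≈0
  ... | no  x≉0 = ^≈0⇒≈0 x k (x*y≈0⇒y≈0 x≉0 xᵏ⁺¹≈0)

  ^-×1# : ∀ p k → (p ℕ.^ k) × 1# ≈ (p × 1#) ^ k
  ^-×1# p zero    = +-identityʳ 1#
  ^-×1# p (suc k) = trans (×1-homo-* p (p ℕ.^ k)) (*-congˡ (^-×1# p k))

  characteristic : ∀ {p k} → q ≡ p ℕ.^ k → p × 1# ≈ 0#
  characteristic {p} {k} q≡pᵏ = ^≈0⇒≈0 (p × 1#) k
    (trans (sym (^-×1# p k)) (subst (λ n → n × 1# ≈ 0#) q≡pᵏ size×1#≈0#))

module Polynomials (R : CommutativeRing 0ℓ 0ℓ) where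
  open import Data.Nat.Base using (zero; suc)
  open import Data.List.Base using ([]; _∷_; [_]; map)
  open import Data.Product.Base using (_,_)
  open import Relation.Binary.Bundles using (Setoid)
  import Relation.Binary.Reasoning.Setoid as SetoidReasoning
  import Algebra.Solver.Ring.NaturalCoefficients.Default as NaturalCoefficients
  open CommutativeRing R renaming (Carrier to A) hiding (zero)
  open import Algebra.Properties.Ring ring using (-0#≈0#)
  open import Algebra.Properties.CommutativeSemigroup +-commutativeSemigroup using (interchange)
  open Poly R
  module ≈-Reasoning = SetoidReasoning setoid

  -- f ≈ₚ g unfolds to a Π-type from which Agda cannot infer f and g; the record keeps them visible.
  infix 4 _≋_
  record _≋_ (f g : Pol) : Set where
    constructor mk≋
    field coeff-≈ : f ≈ₚ g
  open _≋_ public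

  ≋-refl : ∀ {f} → f ≋ f
  ≋-refl = mk≋ λ _ → refl

  ≋-sym : ∀ {f g} → f ≋ g → g ≋ f
  ≋-sym (mk≋ e) = mk≋ λ i → sym (e i)

  ≋-trans : ∀ {f g h} → f ≋ g → g ≋ h → f ≋ h
  ≋-trans (mk≋ e) (mk≋ e′) = mk≋ λ i → trans (e i) (e′ i)

  ≋-setoid : Setoid 0ℓ 0ℓ
  ≋-setoid = record
    { Carrier = Pol ; _≈_ = _≋_
    ; isEquivalence = record { refl = ≋-refl ; sym = ≋-sym ; trans = ≋-trans } }

  module ≋-Reasoning = SetoidReasoning ≋-setoid

  ∷-cong : ∀ {a b f g} → a ≈ b → f ≋ g → (a ∷ f) ≋ (b ∷ g)
  ∷-cong a≈b (mk≋ e) = mk≋ λ { zero → a≈b ; (suc i) → e i }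

  ∷-≋-[] : ∀ {a f} → a ≈ 0# → f ≋ [] → (a ∷ f) ≋ []
  ∷-≋-[] a≈0 (mk≋ e) = mk≋ λ { zero → a≈0 ; (suc i) → e i }

  head-≈ : ∀ {a b f g} → (a ∷ f) ≋ (b ∷ g) → a ≈ b
  head-≈ (mk≋ e) = e zero

  tail-≋ : ∀ {a b f g} → (a ∷ f) ≋ (b ∷ g) → f ≋ g
  tail-≋ (mk≋ e) = mk≋ λ i → e (suc i)

  ∷-≋-[]⇒head≈0 : ∀ {a f} → (a ∷ f) ≋ [] → a ≈ 0#
  ∷-≋-[]⇒head≈0 (mk≋ e) = e zero

  ∷-≋-[]⇒tail≋[] : ∀ {a f} → (a ∷ f) ≋ [] → f ≋ []
  ∷-≋-[]⇒tail≋[] (mk≋ e) = mk≋ λ i → e (suc i)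

  scale : A → Pol → Pol
  scale a = map (a *_)

  negₚ : Pol → Pol
  negₚ = map (λ a → - a)

  coeff-scale : ∀ a f i → coeff (scale a f) i ≈ a * coeff f i
  coeff-scale a []      i       = sym (zeroʳ a)
  coeff-scale a (b ∷ f) zero    = refl
  coeff-scale a (b ∷ f) (suc i) = coeff-scale a f i

  coeff-+ₚ : ∀ f g i → coeff (f +ₚ g) i ≈ coeff f i + coeff g i
  coeff-+ₚ []      g       i       = sym (+-identityˡ _)
  coeff-+ₚ (a ∷ f) []      i       = sym (+-identityʳ _)
  coeff-+ₚ (a ∷ f) (b ∷ g) zero    = refl
  coeff-+ₚ (a ∷ f) (b ∷ g) (suc i) = coeff-+ₚ f g i

  coeff-negₚ : ∀ f i → coeff (negₚ f) i ≈ - coeff f i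
  coeff-negₚ []      i       = sym -0#≈0#
  coeff-negₚ (a ∷ f) zero    = refl
  coeff-negₚ (a ∷ f) (suc i) = coeff-negₚ f i

  +ₚ-cong : ∀ {f f′ g g′} → f ≋ f′ → g ≋ g′ → (f +ₚ g) ≋ (f′ +ₚ g′)
  +ₚ-cong {f} {f′} {g} {g′} (mk≋ e) (mk≋ e′) = mk≋ λ i → begin
    coeff (f +ₚ g) i          ≈⟨ coeff-+ₚ f g i ⟩
    coeff f i + coeff g i     ≈⟨ +-cong (e i) (e′ i) ⟩
    coeff f′ i + coeff g′ i   ≈⟨ coeff-+ₚ f′ g′ i ⟨
    coeff (f′ +ₚ g′) i        ∎
    where open ≈-Reasoning

  +ₚ-congˡ : ∀ f {g g′} → g ≋ g′ → (f +ₚ g) ≋ (f +ₚ g′)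
  +ₚ-congˡ f = +ₚ-cong ≋-refl

  +ₚ-congʳ : ∀ {f f′} g → f ≋ f′ → (f +ₚ g) ≋ (f′ +ₚ g)
  +ₚ-congʳ g f≋f′ = +ₚ-cong f≋f′ ≋-refl

  negₚ-cong : ∀ {f g} → f ≋ g → negₚ f ≋ negₚ g
  negₚ-cong {f} {g} (mk≋ e) = mk≋ λ i →
    trans (coeff-negₚ f i) (trans (-‿cong (e i)) (sym (coeff-negₚ g i)))

  scale-cong : ∀ {a b f g} → a ≈ b → f ≋ g → scale a f ≋ scale b g
  scale-cong {a} {b} {f} {g} a≈b (mk≋ e) = mk≋ λ i →
    trans (coeff-scale a f i) (trans (*-cong a≈b (e i)) (sym (coeff-scale b g i)))

  +ₚ-comm : ∀ f g → (f +ₚ g) ≋ (g +ₚ f)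
  +ₚ-comm f g = mk≋ λ i →
    trans (coeff-+ₚ f g i) (trans (+-comm _ _) (sym (coeff-+ₚ g f i)))

  +ₚ-assoc : ∀ f g h → ((f +ₚ g) +ₚ h) ≋ (f +ₚ (g +ₚ h))
  +ₚ-assoc f g h = mk≋ λ i → begin
    coeff ((f +ₚ g) +ₚ h) i                 ≈⟨ coeff-+ₚ (f +ₚ g) h i ⟩
    coeff (f +ₚ g) i + coeff h i            ≈⟨ +-congʳ (coeff-+ₚ f g i) ⟩
    (coeff f i + coeff g i) + coeff h i     ≈⟨ +-assoc _ _ _ ⟩
    coeff f i + (coeff g i + coeff h i)     ≈⟨ +-congˡ (coeff-+ₚ g h i) ⟨
    coeff f i + coeff (g +ₚ h) i            ≈⟨ coeff-+ₚ f (g +ₚ h) i ⟨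
    coeff (f +ₚ (g +ₚ h)) i                 ∎
    where open ≈-Reasoning

  +ₚ-interchange : ∀ f g h k → ((f +ₚ g) +ₚ (h +ₚ k)) ≋ ((f +ₚ h) +ₚ (g +ₚ k))
  +ₚ-interchange f g h k = mk≋ λ i → begin
    coeff ((f +ₚ g) +ₚ (h +ₚ k)) i
      ≈⟨ trans (coeff-+ₚ (f +ₚ g) (h +ₚ k) i) (+-cong (coeff-+ₚ f g i) (coeff-+ₚ h k i)) ⟩
    (coeff f i + coeff g i) + (coeff h i + coeff k i)
      ≈⟨ interchange _ _ _ _ ⟩
    (coeff f i + coeff h i) + (coeff g i + coeff k i)
      ≈⟨ trans (coeff-+ₚ (f +ₚ h) (g +ₚ k) i) (+-cong (coeff-+ₚ f h i) (coeff-+ₚ g k i)) ⟨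
    coeff ((f +ₚ h) +ₚ (g +ₚ k)) i ∎
    where open ≈-Reasoning

  +ₚ-identityˡ : ∀ f → ([] +ₚ f) ≋ f
  +ₚ-identityˡ f = ≋-refl

  +ₚ-identityʳ : ∀ f → (f +ₚ []) ≋ f
  +ₚ-identityʳ []      = ≋-refl
  +ₚ-identityʳ (a ∷ f) = ≋-refl

  +ₚ-inverseʳ : ∀ f → (f +ₚ negₚ f) ≋ []
  +ₚ-inverseʳ f = mk≋ λ i →
    trans (coeff-+ₚ f (negₚ f) i) (trans (+-congˡ (coeff-negₚ f i)) (-‿inverseʳ _))

  +ₚ-inverseˡ : ∀ f → (negₚ f +ₚ f) ≋ []
  +ₚ-inverseˡ f = ≋-trans (+ₚ-comm (negₚ f) f) (+ₚ-inverseʳ f)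

  scale-distrib-+ₚ : ∀ a f g → scale a (f +ₚ g) ≋ (scale a f +ₚ scale a g)
  scale-distrib-+ₚ a f g = mk≋ λ i → begin
    coeff (scale a (f +ₚ g)) i                  ≈⟨ coeff-scale a (f +ₚ g) i ⟩
    a * coeff (f +ₚ g) i                        ≈⟨ *-congˡ (coeff-+ₚ f g i) ⟩
    a * (coeff f i + coeff g i)                 ≈⟨ distribˡ _ _ _ ⟩
    a * coeff f i + a * coeff g i               ≈⟨ +-cong (coeff-scale a f i) (coeff-scale a g i) ⟨
    coeff (scale a f) i + coeff (scale a g) i   ≈⟨ coeff-+ₚ (scale a f) (scale a g) i ⟨
    coeff (scale a f +ₚ scale a g) i            ∎
    where open ≈-Reasoning

  scale-distrib-+ : ∀ a b f → scale (a + b) f ≋ (scale a f +ₚ scale b f)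
  scale-distrib-+ a b f = mk≋ λ i → begin
    coeff (scale (a + b) f) i                   ≈⟨ coeff-scale (a + b) f i ⟩
    (a + b) * coeff f i                         ≈⟨ distribʳ _ _ _ ⟩
    a * coeff f i + b * coeff f i               ≈⟨ +-cong (coeff-scale a f i) (coeff-scale b f i) ⟨
    coeff (scale a f) i + coeff (scale b f) i   ≈⟨ coeff-+ₚ (scale a f) (scale b f) i ⟨
    coeff (scale a f +ₚ scale b f) i            ∎
    where open ≈-Reasoning

  scale-scale : ∀ a b f → scale a (scale b f) ≋ scale (a * b) f
  scale-scale a b f = mk≋ λ i → begin
    coeff (scale a (scale b f)) i   ≈⟨ coeff-scale a (scale b f) i ⟩
    a * coeff (scale b f) i         ≈⟨ *-congˡ (coeff-scale b f i) ⟩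
    a * (b * coeff f i)             ≈⟨ *-assoc _ _ _ ⟨
    (a * b) * coeff f i             ≈⟨ coeff-scale (a * b) f i ⟨
    coeff (scale (a * b) f) i       ∎
    where open ≈-Reasoning

  scale-1 : ∀ f → scale 1# f ≋ f
  scale-1 f = mk≋ λ i → trans (coeff-scale 1# f i) (*-identityˡ _)

  scale-0 : ∀ f → scale 0# f ≋ []
  scale-0 f = mk≋ λ i → trans (coeff-scale 0# f i) (zeroˡ _)

  *ₚ-zeroˡ : ∀ {f} g → f ≋ [] → (f *ₚ g) ≋ []
  *ₚ-zeroˡ {[]}    g f≋0 = ≋-refl
  *ₚ-zeroˡ {a ∷ f} g f≋0 = +ₚ-cong
    (≋-trans (scale-cong (∷-≋-[]⇒head≈0 f≋0) ≋-refl) (scale-0 g))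
    (∷-≋-[] refl (*ₚ-zeroˡ g (∷-≋-[]⇒tail≋[] f≋0)))

  *ₚ-zeroʳ : ∀ f → (f *ₚ []) ≋ []
  *ₚ-zeroʳ []      = ≋-refl
  *ₚ-zeroʳ (a ∷ f) = ∷-≋-[] refl (*ₚ-zeroʳ f)

  *ₚ-congʳ : ∀ {f f′} g → f ≋ f′ → (f *ₚ g) ≋ (f′ *ₚ g)
  *ₚ-congʳ {[]}    {f′}     g e = ≋-sym (*ₚ-zeroˡ g (≋-sym e))
  *ₚ-congʳ {a ∷ f} {[]}     g e = *ₚ-zeroˡ g e
  *ₚ-congʳ {a ∷ f} {b ∷ f′} g e =
    +ₚ-cong (scale-cong (head-≈ e) ≋-refl) (∷-cong refl (*ₚ-congʳ g (tail-≋ e)))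

  *ₚ-congˡ : ∀ f {g g′} → g ≋ g′ → (f *ₚ g) ≋ (f *ₚ g′)
  *ₚ-congˡ []      e = ≋-refl
  *ₚ-congˡ (a ∷ f) e = +ₚ-cong (scale-cong refl e) (∷-cong refl (*ₚ-congˡ f e))

  *ₚ-cong : ∀ {f f′ g g′} → f ≋ f′ → g ≋ g′ → (f *ₚ g) ≋ (f′ *ₚ g′)
  *ₚ-cong {f′ = f′} {g} e e′ = ≋-trans (*ₚ-congʳ g e) (*ₚ-congˡ f′ e′)

  *ₚ-distribʳ : ∀ f g h → ((f +ₚ g) *ₚ h) ≋ ((f *ₚ h) +ₚ (g *ₚ h))
  *ₚ-distribʳ []      g       h = ≋-refl
  *ₚ-distribʳ (a ∷ f) []      h = ≋-sym (+ₚ-identityʳ _)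
  *ₚ-distribʳ (a ∷ f) (b ∷ g) h = begin
    scale (a + b) h +ₚ (0# ∷ ((f +ₚ g) *ₚ h))
      ≈⟨ +ₚ-cong (scale-distrib-+ a b h) (∷-cong (sym (+-identityʳ 0#)) (*ₚ-distribʳ f g h)) ⟩
    (scale a h +ₚ scale b h) +ₚ ((0# ∷ (f *ₚ h)) +ₚ (0# ∷ (g *ₚ h)))
      ≈⟨ +ₚ-interchange (scale a h) (scale b h) (0# ∷ (f *ₚ h)) (0# ∷ (g *ₚ h)) ⟩
    (scale a h +ₚ (0# ∷ (f *ₚ h))) +ₚ (scale b h +ₚ (0# ∷ (g *ₚ h))) ∎
    where open ≋-Reasoning

  0∷-*ₚ : ∀ f g → ((0# ∷ f) *ₚ g) ≋ (0# ∷ (f *ₚ g))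
  0∷-*ₚ f g = +ₚ-congʳ (0# ∷ (f *ₚ g)) (scale-0 g)

  scale-*ₚ : ∀ a f g → scale a (f *ₚ g) ≋ (scale a f *ₚ g)
  scale-*ₚ a []      g = ≋-refl
  scale-*ₚ a (b ∷ f) g = begin
    scale a (scale b g +ₚ (0# ∷ (f *ₚ g)))
      ≈⟨ scale-distrib-+ₚ a (scale b g) (0# ∷ (f *ₚ g)) ⟩
    scale a (scale b g) +ₚ (a * 0# ∷ scale a (f *ₚ g))
      ≈⟨ +ₚ-cong (scale-scale a b g) (∷-cong (zeroʳ a) (scale-*ₚ a f g)) ⟩
    scale (a * b) g +ₚ (0# ∷ (scale a f *ₚ g)) ∎
    where open ≋-Reasoning

  *ₚ-∷ʳ : ∀ f b g → (f *ₚ (b ∷ g)) ≋ (scale b f +ₚ (0# ∷ (f *ₚ g)))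
  *ₚ-∷ʳ []      b g = ≋-sym (∷-≋-[] refl ≋-refl)
  *ₚ-∷ʳ (a ∷ f) b g = begin
    (a * b ∷ scale a g) +ₚ (0# ∷ (f *ₚ (b ∷ g)))
      ≈⟨ ∷-cong refl (+ₚ-congˡ (scale a g) (*ₚ-∷ʳ f b g)) ⟩
    (a * b + 0# ∷ (scale a g +ₚ (scale b f +ₚ (0# ∷ (f *ₚ g)))))
      ≈⟨ ∷-cong (+-congʳ (*-comm a b)) (swap (scale a g) (scale b f) (0# ∷ (f *ₚ g))) ⟩
    (b * a + 0# ∷ (scale b f +ₚ (scale a g +ₚ (0# ∷ (f *ₚ g))))) ∎
    where
    open ≋-Reasoning
    swap : ∀ f g h → (f +ₚ (g +ₚ h)) ≋ (g +ₚ (f +ₚ h))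
    swap f g h = ≋-trans (≋-sym (+ₚ-assoc f g h))
      (≋-trans (+ₚ-congʳ h (+ₚ-comm f g)) (+ₚ-assoc g f h))

  *ₚ-comm : ∀ f g → (f *ₚ g) ≋ (g *ₚ f)
  *ₚ-comm []      g = ≋-sym (*ₚ-zeroʳ g)
  *ₚ-comm (a ∷ f) g = ≋-sym (≋-trans (*ₚ-∷ʳ g a f) (+ₚ-congˡ (scale a g) (∷-cong refl (*ₚ-comm g f))))

  *ₚ-distribˡ : ∀ f g h → (f *ₚ (g +ₚ h)) ≋ ((f *ₚ g) +ₚ (f *ₚ h))
  *ₚ-distribˡ f g h = ≋-trans (*ₚ-comm f (g +ₚ h))
    (≋-trans (*ₚ-distribʳ g h f) (+ₚ-cong (*ₚ-comm g f) (*ₚ-comm h f)))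

  *ₚ-assoc : ∀ f g h → ((f *ₚ g) *ₚ h) ≋ (f *ₚ (g *ₚ h))
  *ₚ-assoc []      g h = ≋-refl
  *ₚ-assoc (a ∷ f) g h = begin
    (scale a g +ₚ (0# ∷ (f *ₚ g))) *ₚ h
      ≈⟨ *ₚ-distribʳ (scale a g) (0# ∷ (f *ₚ g)) h ⟩
    (scale a g *ₚ h) +ₚ ((0# ∷ (f *ₚ g)) *ₚ h)
      ≈⟨ +ₚ-cong (≋-sym (scale-*ₚ a g h)) (≋-trans (0∷-*ₚ (f *ₚ g) h) (∷-cong refl (*ₚ-assoc f g h))) ⟩
    scale a (g *ₚ h) +ₚ (0# ∷ (f *ₚ (g *ₚ h))) ∎
    where open ≋-Reasoning

  *ₚ-identityˡ : ∀ f → ([ 1# ] *ₚ f) ≋ f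
  *ₚ-identityˡ f = ≋-trans (+ₚ-cong (scale-1 f) (∷-≋-[] refl ≋-refl)) (+ₚ-identityʳ f)

  *ₚ-identityʳ : ∀ f → (f *ₚ [ 1# ]) ≋ f
  *ₚ-identityʳ f = ≋-trans (*ₚ-comm f [ 1# ]) (*ₚ-identityˡ f)

  scale≋const-*ₚ : ∀ a f → scale a f ≋ ([ a ] *ₚ f)
  scale≋const-*ₚ a f = ≋-sym (≋-trans (+ₚ-congˡ (scale a f) (∷-≋-[] refl ≋-refl)) (+ₚ-identityʳ _))

  polynomialRing : CommutativeRing 0ℓ 0ℓ
  polynomialRing = record
    { Carrier = Pol ; _≈_ = _≋_ ; _+_ = _+ₚ_ ; _*_ = _*ₚ_ ; -_ = negₚ ; 0# = [] ; 1# = [ 1# ]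
    ; isCommutativeRing = record
      { isRing = record
        { +-isAbelianGroup = record
          { isGroup = record
            { isMonoid = record
              { isSemigroup = record
                { isMagma = record { isEquivalence = Setoid.isEquivalence ≋-setoid ; ∙-cong = +ₚ-cong }
                ; assoc = +ₚ-assoc }
              ; identity = +ₚ-identityˡ , +ₚ-identityʳ }
            ; inverse = +ₚ-inverseˡ , +ₚ-inverseʳ
            ; ⁻¹-cong = negₚ-cong }
          ; comm = +ₚ-comm }
        ; *-cong = *ₚ-cong
        ; *-assoc = *ₚ-assoc
        ; *-identity = *ₚ-identityˡ , *ₚ-identityʳ
        ; distrib = *ₚ-distribˡ , λ f g h → *ₚ-distribʳ g h f }
      ; *-comm = *ₚ-comm } }

  module PolynomialRing = CommutativeRing polynomialRing
  module *ₚ-Solver = NaturalCoefficients PolynomialRing.commutativeSemiring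

module PolynomialDivisibility (R : CommutativeRing 0ℓ 0ℓ) where
  open import Data.List.Base using (_∷_; [_])
  open import Data.List.Relation.Unary.Any using (Any; here; there)
  open import Data.Product.Base using (_,_)
  open CommutativeRing R using (1#)
  open Poly R
  open Polynomials R

  infix 4 _∣_
  record _∣_ (f h : Pol) : Set where
    constructor divides
    field
      quotient : Pol
      equality : (f *ₚ quotient) ≋ h

  ∣ₚ⇒∣ : ∀ {f h} → f ∣ₚ h → f ∣ h
  ∣ₚ⇒∣ (r , e) = divides r (mk≋ e)

  ∣⇒∣ₚ : ∀ {f h} → f ∣ h → f ∣ₚ h
  ∣⇒∣ₚ (divides r e) = r , coeff-≈ e

  ∣-refl : ∀ {f} → f ∣ f
  ∣-refl {f} = divides [ 1# ] (*ₚ-identityʳ f)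

  ∣-trans : ∀ {f g h} → f ∣ g → g ∣ h → f ∣ h
  ∣-trans {f} (divides r fr≋g) (divides s gs≋h) =
    divides (r *ₚ s) (≋-trans (≋-sym (*ₚ-assoc f r s)) (≋-trans (*ₚ-congʳ s fr≋g) gs≋h))

  ∣-respˡ : ∀ {f f′ h} → f ≋ f′ → f ∣ h → f′ ∣ h
  ∣-respˡ f≋f′ (divides r fr≋h) = divides r (≋-trans (*ₚ-congʳ r (≋-sym f≋f′)) fr≋h)

  ∣-respʳ : ∀ {f h h′} → h ≋ h′ → f ∣ h → f ∣ h′
  ∣-respʳ h≋h′ (divides r fr≋h) = divides r (≋-trans fr≋h h≋h′)

  ∣-*ₚʳ : ∀ {f g} h → f ∣ g → f ∣ (g *ₚ h)
  ∣-*ₚʳ {f} h (divides r fr≋g) =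
    divides (r *ₚ h) (≋-trans (≋-sym (*ₚ-assoc f r h)) (*ₚ-congʳ h fr≋g))

  ∣-*ₚˡ : ∀ {f} g h → f ∣ h → f ∣ (g *ₚ h)
  ∣-*ₚˡ g h f∣h = ∣-respʳ (*ₚ-comm h g) (∣-*ₚʳ g f∣h)

  ∣-+ₚ : ∀ {f g h} → f ∣ g → f ∣ h → f ∣ (g +ₚ h)
  ∣-+ₚ {f} (divides r fr≋g) (divides s fs≋h) =
    divides (r +ₚ s) (≋-trans (*ₚ-distribˡ f r s) (+ₚ-cong fr≋g fs≋h))

  ∣-scale : ∀ {f g} c → f ∣ g → f ∣ scale c g
  ∣-scale {g = g} c f∣g = ∣-respʳ (≋-sym (scale≋const-*ₚ c g)) (∣-*ₚˡ [ c ] g f∣g)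

  record Coprime (f g : Pol) : Set where
    constructor bézout
    field
      u v : Pol
      identity : [ 1# ] ≋ ((u *ₚ f) +ₚ (v *ₚ g))

  module _ {f g : Pol} (f⊥g : Coprime f g) where
    open Coprime f⊥g
    open *ₚ-Solver using (solve; _:=_; _:+_; _:*_)
    open ≋-Reasoning

    coprime-divisor : ∀ {h} → f ∣ (g *ₚ h) → f ∣ h
    coprime-divisor {h} f∣gh = ∣-respʳ (begin
      (f *ₚ (u *ₚ h)) +ₚ (v *ₚ (g *ₚ h))
        ≈⟨ solve 5 (λ f u h v g → f :* (u :* h) :+ v :* (g :* h) := (u :* f :+ v :* g) :* h) ≋-refl f u h v g ⟩
      ((u *ₚ f) +ₚ (v *ₚ g)) *ₚ h  ≈⟨ *ₚ-congʳ h identity ⟨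
      [ 1# ] *ₚ h                   ≈⟨ *ₚ-identityˡ h ⟩
      h                             ∎) (∣-+ₚ (∣-*ₚʳ (u *ₚ h) ∣-refl) (∣-*ₚˡ v (g *ₚ h) f∣gh))

    coprime-∣⇒*ₚ-∣ : ∀ {h} → f ∣ h → g ∣ h → (f *ₚ g) ∣ h
    coprime-∣⇒*ₚ-∣ {h} (divides r fr≋h) (divides s gs≋h) = divides (u *ₚ s +ₚ v *ₚ r) (begin
      (f *ₚ g) *ₚ (u *ₚ s +ₚ v *ₚ r)
        ≈⟨ solve 6 (λ f g u s v r → (f :* g) :* (u :* s :+ v :* r) := (u :* f) :* (g :* s) :+ (v :* g) :* (f :* r))
                 ≋-refl f g u s v r ⟩
      ((u *ₚ f) *ₚ (g *ₚ s)) +ₚ ((v *ₚ g) *ₚ (f *ₚ r))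
        ≈⟨ +ₚ-cong (*ₚ-congˡ (u *ₚ f) gs≋h) (*ₚ-congˡ (v *ₚ g) fr≋h) ⟩
      ((u *ₚ f) *ₚ h) +ₚ ((v *ₚ g) *ₚ h)                ≈⟨ *ₚ-distribʳ (u *ₚ f) (v *ₚ g) h ⟨
      ((u *ₚ f) +ₚ (v *ₚ g)) *ₚ h                       ≈⟨ *ₚ-congʳ h identity ⟨
      [ 1# ] *ₚ h                                       ≈⟨ *ₚ-identityˡ h ⟩
      h                                                 ∎)

  any-≈ₚ⇒∣prodₚ : ∀ {f gs} → Any (λ g → toPol f ≈ₚ toPol g) gs → toPol f ∣ prodₚ gs
  any-≈ₚ⇒∣prodₚ {f} {g ∷ gs} (here f≈g)  =
    ∣-respˡ (≋-sym (mk≋ f≈g)) (∣-*ₚʳ (prodₚ gs) (∣-refl {toPol g}))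
  any-≈ₚ⇒∣prodₚ {f} {g ∷ gs} (there f∈gs) =
    ∣-*ₚˡ (toPol g) (prodₚ gs) (any-≈ₚ⇒∣prodₚ f∈gs)

module LeadingTerms (R : CommutativeRing 0ℓ 0ℓ) where
  open import Data.Nat.Base as ℕ using (ℕ; zero; suc; _≤_; _<_; s≤s; z≤n)
  open import Data.Nat.Properties using (≤-refl; <⇒≤; ≤-<-trans; m≤n+m; <-cmp)
  open import Data.Nat.ListAction using (sum)
  open import Data.List.Base using ([]; _∷_; [_]; map)
  open import Data.Vec.Base using ([]; _∷_)
  open import Data.Product.Base using (_,_)
  open import Relation.Binary.Definitions using (tri<; tri≈; tri>)
  open import Relation.Binary.PropositionalEquality.Core using (_≡_)
  open import Relation.Nullary using (¬_; contradiction)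
  open CommutativeRing R renaming (Carrier to A) hiding (zero)
  open Poly R
  open Polynomials R

  -- c may be 0#, in which case this only bounds the degree of h by d.
  record HasLeadingTerm (h : Pol) (d : ℕ) (c : A) : Set where
    constructor leading
    field
      coeff-deg : coeff h d ≈ c
      coeff-above : ∀ j → d < j → coeff h j ≈ 0#

  HasLeadingTerm-resp : ∀ {h h′ d c} → h ≋ h′ → HasLeadingTerm h d c → HasLeadingTerm h′ d c
  HasLeadingTerm-resp (mk≋ e) (leading top above) =
    leading (trans (sym (e _)) top) λ j d<j → trans (sym (e j)) (above j d<j)

  HasLeadingTerm-resp-coeff : ∀ {h d c c′} → c ≈ c′ → HasLeadingTerm h d c → HasLeadingTerm h d c′
  HasLeadingTerm-resp-coeff c≈c′ (leading top above) = leading (trans top c≈c′) above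

  HasLeadingTerm-∷ : ∀ {a h d c} → HasLeadingTerm h d c → HasLeadingTerm (a ∷ h) (suc d) c
  HasLeadingTerm-∷ (leading top above) = leading top λ { (suc j) (s≤s d<j) → above j d<j }

  HasLeadingTerm-[1#] : HasLeadingTerm [ 1# ] 0 1#
  HasLeadingTerm-[1#] = leading refl λ { (suc j) _ → refl }

  HasLeadingTerm-monic : ∀ f → HasLeadingTerm (toPol f) (deg f) 1#
  HasLeadingTerm-monic (zero  , [])    = HasLeadingTerm-[1#]
  HasLeadingTerm-monic (suc d , a ∷ v) = HasLeadingTerm-∷ (HasLeadingTerm-monic (d , v))

  HasLeadingTerm-scale : ∀ {f d c} a → HasLeadingTerm f d c → HasLeadingTerm (scale a f) d (a * c)
  HasLeadingTerm-scale {f} {d} a (leading top above) = leading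
    (trans (coeff-scale a f d) (*-congˡ top))
    λ j d<j → trans (coeff-scale a f j) (trans (*-congˡ (above j d<j)) (zeroʳ a))

  HasLeadingTerm-scale-monic : ∀ a f → HasLeadingTerm (scale a (toPol f)) (deg f) a
  HasLeadingTerm-scale-monic a f =
    HasLeadingTerm-resp-coeff (*-identityʳ a) (HasLeadingTerm-scale a (HasLeadingTerm-monic f))

  HasLeadingTerm-+ₚˡ : ∀ {g h d c} → (∀ j → d ≤ j → coeff g j ≈ 0#) →
                       HasLeadingTerm h d c → HasLeadingTerm (g +ₚ h) d c
  HasLeadingTerm-+ₚˡ {g} {h} {d} g-low (leading top above) = leading
    (trans (coeff-+ₚ g h d) (trans (+-cong (g-low d ≤-refl) top) (+-identityˡ _)))
    λ j d<j → trans (coeff-+ₚ g h j) (trans (+-cong (g-low j (<⇒≤ d<j)) (above j d<j)) (+-identityˡ _))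

  HasLeadingTerm-*ₚ : ∀ {f g a b c c′} → HasLeadingTerm f a c → HasLeadingTerm g b c′ →
                      HasLeadingTerm (f *ₚ g) (a ℕ.+ b) (c * c′)
  HasLeadingTerm-*ₚ {[]} {c′ = c′} (leading top _) _ =
    leading (trans (sym (zeroˡ c′)) (*-congʳ top)) λ _ _ → refl
  HasLeadingTerm-*ₚ {x ∷ f} {g} {zero} (leading top above) g-lt = HasLeadingTerm-resp
    (≋-sym (≋-trans (+ₚ-congˡ (scale x g) (∷-≋-[] refl (*ₚ-zeroˡ g f≋[]))) (+ₚ-identityʳ (scale x g))))
    (HasLeadingTerm-resp-coeff (*-congʳ top) (HasLeadingTerm-scale x g-lt))
    where
    f≋[] : f ≋ []
    f≋[] = mk≋ λ i → above (suc i) (s≤s z≤n)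
  HasLeadingTerm-*ₚ {x ∷ f} {g} {suc a} {b} (leading top above) g-lt@(leading _ g-above) =
    HasLeadingTerm-+ₚˡ scale-low
      (HasLeadingTerm-∷ (HasLeadingTerm-*ₚ {f} (leading top λ j a<j → above (suc j) (s≤s a<j)) g-lt))
    where
    scale-low : ∀ j → suc (a ℕ.+ b) ≤ j → coeff (scale x g) j ≈ 0#
    scale-low j a+b<j = trans (coeff-scale x g j)
      (trans (*-congˡ (g-above j (≤-<-trans (m≤n+m b a) a+b<j))) (zeroʳ x))

  degree-unique : ∀ {h d d′ c c′} → ¬ c ≈ 0# → ¬ c′ ≈ 0# →
                  HasLeadingTerm h d c → HasLeadingTerm h d′ c′ → d ≡ d′
  degree-unique {d = d} {d′} c≉0 c′≉0 (leading top above) (leading top′ above′) with <-cmp d d′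
  ... | tri< d<d′ _ _ = contradiction (trans (sym top′) (above d′ d<d′)) c′≉0
  ... | tri≈ _ d≡d′ _ = d≡d′
  ... | tri> _ _ d′<d = contradiction (trans (sym top) (above′ d d′<d)) c≉0

  leadingCoeff-unique : ∀ {h d c c′} → HasLeadingTerm h d c → HasLeadingTerm h d c′ → c ≈ c′
  leadingCoeff-unique (leading top _) (leading top′ _) = trans (sym top) top′

  ≋[]⇒leadingCoeff≈0 : ∀ {h d c} → h ≋ [] → HasLeadingTerm h d c → c ≈ 0#
  ≋[]⇒leadingCoeff≈0 (mk≋ e) (leading top _) = trans (sym top) (e _)

  HasLeadingTerm-prodₚ : ∀ fs → HasLeadingTerm (prodₚ fs) (sum (map deg fs)) 1#
  HasLeadingTerm-prodₚ []       = HasLeadingTerm-[1#]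
  HasLeadingTerm-prodₚ (f ∷ fs) = HasLeadingTerm-resp-coeff (*-identityˡ 1#)
    (HasLeadingTerm-*ₚ (HasLeadingTerm-monic f) (HasLeadingTerm-prodₚ fs))

module PolynomialsOverField (F : CommutativeRing 0ℓ 0ℓ) (isField : Poly.IsField F)
                            (_≟_ : Decidable (CommutativeRing._≈_ F)) where
  open import Data.Nat.Base as ℕ using (zero; suc; _≤_; _<_; s≤s; z≤n)
  import Data.Nat.Properties as ℕ
  open import Data.List.Base using ([]; _∷_; [_]; length)
  open import Data.List.Relation.Unary.All using (All; []; _∷_)
  open import Data.List.Relation.Unary.AllPairs using (AllPairs; []; _∷_)
  open import Data.Vec.Base using (Vec; []; _∷_)
  open import Data.Product.Base using (Σ; _×_; _,_)
  open import Data.Sum.Base using (inj₁; inj₂)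
  open import Relation.Binary.PropositionalEquality as ≡ using (_≡_)
  open import Relation.Nullary using (¬_; yes; no; contradiction)
  open CommutativeRing F renaming (Carrier to A) hiding (zero)
  open Poly F
  open Polynomials F
  open PolynomialDivisibility F
  open LeadingTerms F
  open FieldProperties F isField
  open import Algebra.Properties.Ring PolynomialRing.ring using (-‿distribˡ-*)
  open import Algebra.Properties.Group PolynomialRing.+-group using (\\-leftDividesʳ)
  open *ₚ-Solver using (solve; _:=_; _:+_; _:*_)

  data Normalised (h : Pol) : Set where
    null   : h ≋ [] → Normalised h
    scaled : ∀ c (g : Monic) → ¬ c ≈ 0# → h ≋ scale c (toPol g) → deg g < length h → Normalised h

  normalise : ∀ h → Normalised h
  normalise []      = null ≋-refl
  normalise (a ∷ h) with normalise h
  ... | scaled c (d , v) c≉0 h≋cg d<len =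
    scaled c (suc d , c ⁻¹[ c≉0 ] * a ∷ v) c≉0 (∷-cong (sym (x*[x⁻¹*y]≈y c c≉0 a)) h≋cg) (s≤s d<len)
  ... | null h≋[] with a ≟ 0#
  ...   | yes a≈0 = null (∷-≋-[] a≈0 h≋[])
  ...   | no  a≉0 = scaled a (0 , []) a≉0 (∷-cong (sym (*-identityʳ a)) h≋[]) (s≤s z≤n)

  record DivMod (f : Monic) (h : Pol) : Set where
    constructor divMod≋
    field
      quotient remainder : Pol
      h≋fq+r : h ≋ (toPol f *ₚ quotient) +ₚ remainder
      length-remainder≤deg : length remainder ≤ deg f

  -- The top step of long division: cancel the leading coefficient of h by a multiple of the monic divisor.
  divModTop : ∀ {d} (v : Vec A d) h → length h ≡ suc d →
              Σ A λ c → Σ Pol λ r → (h ≋ (scale c (toPol (d , v)) +ₚ r)) × (length r ≤ d)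
  divModTop []      (c ∷ []) _ = c , [] , ∷-cong (sym (*-identityʳ c)) ≋-refl , z≤n
  divModTop (b ∷ v) (a ∷ h) len with divModTop v h (ℕ.suc-injective len)
  ... | c , r , h≋cf+r , len-r = c , (a - c * b) ∷ r , ∷-cong a≈cb+[a-cb] h≋cf+r , s≤s len-r
    where
    a≈cb+[a-cb] : a ≈ c * b + (a - c * b)
    a≈cb+[a-cb] = sym (trans (+-comm _ _) (trans (+-assoc _ _ _)
                    (trans (+-congˡ (-‿inverseˡ _)) (+-identityʳ a))))

  shift-division : ∀ f {a h q r} → h ≋ ((f *ₚ q) +ₚ r) → (a ∷ h) ≋ ((f *ₚ (0# ∷ q)) +ₚ (a ∷ r))
  shift-division f {a} {h} {q} {r} h≋fq+r = begin
    a ∷ h                        ≈⟨ ∷-cong (sym (+-identityˡ a)) h≋fq+r ⟩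
    (0# ∷ (f *ₚ q)) +ₚ (a ∷ r)   ≈⟨ +ₚ-congʳ (a ∷ r) (≋-trans (*ₚ-∷ʳ f 0# q) (+ₚ-congʳ _ (scale-0 f))) ⟨
    (f *ₚ (0# ∷ q)) +ₚ (a ∷ r)   ∎
    where open ≋-Reasoning

  divMod : ∀ f h → DivMod f h
  divMod f []      = divMod≋ [] [] (≋-sym (≋-trans (+ₚ-identityʳ _) (*ₚ-zeroʳ (toPol f)))) z≤n
  divMod f@(d , v) (a ∷ h) with divMod f h
  ... | divMod≋ q r h≋fq+r len-r with ℕ.m≤n⇒m<n∨m≡n len-r
  ...   | inj₁ len-r<d = divMod≋ (0# ∷ q) (a ∷ r) (shift-division (toPol f) h≋fq+r) len-r<d
  ...   | inj₂ len-r≡d with divModTop v (a ∷ r) (≡.cong suc len-r≡d)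
  ...     | c , r′ , a∷r≋cf+r′ , len-r′ = divMod≋ ((0# ∷ q) +ₚ [ c ]) r′ (begin
    a ∷ h
      ≈⟨ shift-division (toPol f) h≋fq+r ⟩
    (toPol f *ₚ (0# ∷ q)) +ₚ (a ∷ r)
      ≈⟨ +ₚ-congˡ _ (≋-trans a∷r≋cf+r′ (+ₚ-congʳ r′ (scale≋const-*ₚ c (toPol f)))) ⟩
    (toPol f *ₚ (0# ∷ q)) +ₚ (([ c ] *ₚ toPol f) +ₚ r′)
      ≈⟨ solve 4 (λ f q c r → f :* q :+ (c :* f :+ r) := f :* (q :+ c) :+ r) ≋-refl (toPol f) (0# ∷ q) [ c ] r′ ⟩
    (toPol f *ₚ ((0# ∷ q) +ₚ [ c ])) +ₚ r′ ∎) len-r′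
    where open ≋-Reasoning

  remainder≋ : ∀ f q {r h} → h ≋ ((f *ₚ q) +ₚ r) → r ≋ ((negₚ q *ₚ f) +ₚ h)
  remainder≋ f q {r} {h} h≋fq+r = begin
    r                                  ≈⟨ \\-leftDividesʳ (f *ₚ q) r ⟨
    negₚ (f *ₚ q) +ₚ ((f *ₚ q) +ₚ r)   ≈⟨ +ₚ-cong (≋-trans (negₚ-cong (*ₚ-comm f q)) (-‿distribˡ-* q f)) (≋-sym h≋fq+r) ⟩
    (negₚ q *ₚ f) +ₚ h                 ∎
    where open ≋-Reasoning

  record Gcd (f : Monic) (g : Pol) : Set where
    constructor gcd≋
    field
      divisor : Monic
      divisor∣f : toPol divisor ∣ toPol f
      divisor∣g : toPol divisor ∣ g
      u v : Pol
      bezout : toPol divisor ≋ ((u *ₚ toPol f) +ₚ (v *ₚ g))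

  unscale : ∀ {c h g} (c≉0 : ¬ c ≈ 0#) → h ≋ scale c g → g ≋ ([ c ⁻¹[ c≉0 ] ] *ₚ h)
  unscale {c} {h} {g} c≉0 h≋cg = begin
    g                           ≈⟨ scale-1 g ⟨
    scale 1# g                  ≈⟨ scale-cong (*-inverseˡ c c≉0) ≋-refl ⟨
    scale (c ⁻¹[ c≉0 ] * c) g   ≈⟨ scale-scale _ c g ⟨
    scale (c ⁻¹[ c≉0 ]) (scale c g) ≈⟨ scale-cong refl h≋cg ⟨
    scale (c ⁻¹[ c≉0 ]) h       ≈⟨ scale≋const-*ₚ _ h ⟩
    [ c ⁻¹[ c≉0 ] ] *ₚ h        ∎
    where open ≋-Reasoning

  -- Euclid's algorithm; n is fuel bounding deg f.
  gcd : ∀ n f → deg f < n → ∀ g → Gcd f g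
  gcd (suc n) f deg<n g with divMod f g
  ... | divMod≋ q r g≋fq+r len-r with normalise r
  ...   | null r≋[] = gcd≋ f ∣-refl (divides q g≋fq) [ 1# ] [] f≋1f+0g
    where
    g≋fq : (toPol f *ₚ q) ≋ g
    g≋fq = ≋-sym (≋-trans g≋fq+r (≋-trans (+ₚ-congˡ _ r≋[]) (+ₚ-identityʳ _)))
    f≋1f+0g : toPol f ≋ (([ 1# ] *ₚ toPol f) +ₚ ([] *ₚ g))
    f≋1f+0g = ≋-sym (≋-trans (+ₚ-identityʳ _) (*ₚ-identityˡ _))
  ...   | scaled c h c≉0 r≋ch deg<len
    with gcd n h (ℕ.<-≤-trans deg<len (ℕ.≤-trans len-r (ℕ.≤-pred deg<n))) (toPol f)
  ...     | gcd≋ d d∣h d∣f u v d≋uh+vf = gcd≋ d d∣f d∣g (v +ₚ (u′ *ₚ negₚ q)) u′ (begin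
    toPol d                                            ≈⟨ d≋uh+vf ⟩
    (u *ₚ toPol h) +ₚ (v *ₚ toPol f)                   ≈⟨ +ₚ-congʳ _ (*ₚ-congˡ u h≋c⁻¹r) ⟩
    (u *ₚ ([ c⁻¹ ] *ₚ ((negₚ q *ₚ toPol f) +ₚ g))) +ₚ (v *ₚ toPol f)
      ≈⟨ solve 6 (λ u c q f g v → u :* (c :* (q :* f :+ g)) :+ v :* f := (v :+ (u :* c) :* q) :* f :+ (u :* c) :* g)
               ≋-refl u [ c⁻¹ ] (negₚ q) (toPol f) g v ⟩
    ((v +ₚ (u′ *ₚ negₚ q)) *ₚ toPol f) +ₚ (u′ *ₚ g)    ∎)
    where
    open ≋-Reasoning
    c⁻¹ : A
    c⁻¹ = c ⁻¹[ c≉0 ]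
    u′ : Pol
    u′ = u *ₚ [ c⁻¹ ]
    h≋c⁻¹r : toPol h ≋ ([ c⁻¹ ] *ₚ ((negₚ q *ₚ toPol f) +ₚ g))
    h≋c⁻¹r = ≋-trans (unscale c≉0 r≋ch) (*ₚ-congˡ [ c⁻¹ ] (remainder≋ (toPol f) q g≋fq+r))
    d∣g : toPol d ∣ g
    d∣g = ∣-respʳ (≋-sym (≋-trans g≋fq+r (+ₚ-congˡ _ r≋ch))) (∣-+ₚ (∣-*ₚʳ q d∣f) (∣-scale c d∣h))

  Irreducible : Monic → Set
  Irreducible f = IsIrreducible (toPol f)

  irreducible-coprime : ∀ {f} → Irreducible f → ∀ {g} → ¬ toPol f ∣ g → Coprime (toPol f) g
  irreducible-coprime {f} (_ , _ , factors) {g} f∤g with gcd (suc (deg f)) f (ℕ.n<1+n (deg f)) g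
  ... | gcd≋ d (divides r dr≋f) d∣g u v d≋uf+vg with factors (toPol d) r (coeff-≈ dr≋f)
  ...   | inj₁ (t , dt≈1) = bézout (u *ₚ t) (v *ₚ t) (begin
    [ 1# ]                                       ≈⟨ mk≋ dt≈1 ⟨
    toPol d *ₚ t                                 ≈⟨ *ₚ-congʳ t d≋uf+vg ⟩
    ((u *ₚ toPol f) +ₚ (v *ₚ g)) *ₚ t
      ≈⟨ solve 5 (λ u f v g t → (u :* f :+ v :* g) :* t := (u :* t) :* f :+ (v :* t) :* g) ≋-refl u (toPol f) v g t ⟩
    ((u *ₚ t) *ₚ toPol f) +ₚ ((v *ₚ t) *ₚ g)     ∎)
    where open ≋-Reasoning
  ...   | inj₂ (t , rt≈1) = contradiction (∣-trans f∣d d∣g) f∤g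
    where
    f∣d : toPol f ∣ toPol d
    f∣d = divides t (begin
      toPol f *ₚ t             ≈⟨ *ₚ-congʳ t dr≋f ⟨
      (toPol d *ₚ r) *ₚ t      ≈⟨ *ₚ-assoc (toPol d) r t ⟩
      toPol d *ₚ (r *ₚ t)      ≈⟨ *ₚ-congˡ (toPol d) (mk≋ rt≈1) ⟩
      toPol d *ₚ [ 1# ]        ≈⟨ *ₚ-identityʳ (toPol d) ⟩
      toPol d                  ∎)
      where open ≋-Reasoning

  irreducible-∣-*ₚ : ∀ {f} → Irreducible f → ∀ {g h} → toPol f ∣ (g *ₚ h) → ¬ toPol f ∣ g → toPol f ∣ h
  irreducible-∣-*ₚ f-irr f∣gh f∤g = coprime-divisor (irreducible-coprime f-irr f∤g) f∣gh

  [1#]≉[] : ¬ [ 1# ] ≋ []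
  [1#]≉[] 1≋0 = 1#≉0# (coeff-≈ 1≋0 0)

  deg≡0⇒toPol≡[1#] : ∀ (g : Monic) → deg g ≡ 0 → toPol g ≡ [ 1# ]
  deg≡0⇒toPol≡[1#] (zero , []) _ = ≡.refl

  unit⇒constant : ∀ {r u} → (r *ₚ u) ≋ [ 1# ] → Σ A λ c → (¬ c ≈ 0#) × (r ≋ [ c ])
  unit⇒constant {r} {u} ru≋1 with normalise r | normalise u
  ... | null r≋[] | _ = contradiction (≋-trans (≋-sym ru≋1) (*ₚ-zeroˡ u r≋[])) [1#]≉[]
  ... | scaled _ _ _ _ _ | null u≋[] =
    contradiction (≋-trans (≋-sym ru≋1) (≋-trans (*ₚ-congˡ r u≋[]) (*ₚ-zeroʳ r))) [1#]≉[]
  ... | scaled c g c≉0 r≋cg _ | scaled c′ g′ c′≉0 u≋c′g′ _ = c , c≉0 , (begin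
    r                   ≈⟨ r≋cg ⟩
    scale c (toPol g)   ≡⟨ ≡.cong (scale c) (deg≡0⇒toPol≡[1#] g (ℕ.m+n≡0⇒m≡0 (deg g) deg-g+deg-g′≡0)) ⟩
    [ c * 1# ]          ≈⟨ ∷-cong (*-identityʳ c) ≋-refl ⟩
    [ c ]               ∎)
    where
    open ≋-Reasoning
    deg-g+deg-g′≡0 : deg g ℕ.+ deg g′ ≡ 0
    deg-g+deg-g′≡0 = degree-unique (*-≉0 c≉0 c′≉0) 1#≉0#
      (HasLeadingTerm-resp (≋-sym (*ₚ-cong r≋cg u≋c′g′))
        (HasLeadingTerm-*ₚ (HasLeadingTerm-scale-monic c g) (HasLeadingTerm-scale-monic c′ g′)))
      (HasLeadingTerm-resp (≋-sym ru≋1) HasLeadingTerm-[1#])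

  irreducible-∣⇒≋ : ∀ {f g} → Irreducible f → Irreducible g → toPol f ∣ toPol g → toPol f ≋ toPol g
  irreducible-∣⇒≋ {f} {g} (_ , f-nonunit , _) (_ , _ , g-factors) (divides r fr≋g)
    with g-factors (toPol f) r (coeff-≈ fr≋g)
  ... | inj₁ f-unit = contradiction f-unit f-nonunit
  ... | inj₂ (u , ru≈1) with unit⇒constant (mk≋ ru≈1)
  ...   | c , c≉0 , r≋c = begin
    toPol f              ≈⟨ scale-1 (toPol f) ⟨
    scale 1# (toPol f)   ≈⟨ scale-cong 1≈c ≋-refl ⟩
    scale c (toPol f)    ≈⟨ g≋cf ⟨
    toPol g              ∎
    where
    open ≋-Reasoning
    g≋cf : toPol g ≋ scale c (toPol f)
    g≋cf = ≋-trans (≋-sym fr≋g) (≋-trans (*ₚ-congˡ (toPol f) r≋c)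
             (≋-trans (*ₚ-comm (toPol f) [ c ]) (≋-sym (scale≋const-*ₚ c (toPol f)))))
    g-leading : HasLeadingTerm (toPol g) (deg f) c
    g-leading = HasLeadingTerm-resp (≋-sym g≋cf) (HasLeadingTerm-scale-monic c f)
    deg-f≡deg-g : deg f ≡ deg g
    deg-f≡deg-g = degree-unique c≉0 1#≉0# g-leading (HasLeadingTerm-monic g)
    1≈c : 1# ≈ c
    1≈c = leadingCoeff-unique
      (≡.subst (λ d → HasLeadingTerm (toPol g) d 1#) (≡.sym deg-f≡deg-g) (HasLeadingTerm-monic g)) g-leading

  irreducible-∤prodₚ : ∀ {f} → Irreducible f → ∀ {gs} → All Irreducible gs →
                       All (λ g → ¬ toPol f ≈ₚ toPol g) gs → ¬ toPol f ∣ prodₚ gs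
  irreducible-∤prodₚ (_ , f-nonunit , _) []             []             (divides r fr≋1) = f-nonunit (r , coeff-≈ fr≋1)
  irreducible-∤prodₚ f-irr {g ∷ gs}      (g-irr ∷ gs-irr) (f≉g ∷ f≉gs) f∣ggs =
    irreducible-∤prodₚ f-irr gs-irr f≉gs
      (irreducible-∣-*ₚ f-irr f∣ggs λ f∣g → f≉g (coeff-≈ (irreducible-∣⇒≋ {g = g} f-irr g-irr f∣g)))

  distinct-irreducibles-∣⇒prodₚ-∣ : ∀ {fs h} → All Irreducible fs → AllPairs (λ f g → ¬ toPol f ≈ₚ toPol g) fs →
    All (λ f → toPol f ∣ h) fs → prodₚ fs ∣ h
  distinct-irreducibles-∣⇒prodₚ-∣ {[]}    {h} _ _ _ = divides h (*ₚ-identityˡ h)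
  distinct-irreducibles-∣⇒prodₚ-∣ {f ∷ fs}     (f-irr ∷ fs-irr) (f≉fs ∷ fs-distinct) (f∣h ∷ fs∣h) =
    coprime-∣⇒*ₚ-∣ (irreducible-coprime f-irr (irreducible-∤prodₚ f-irr fs-irr f≉fs))
      f∣h (distinct-irreducibles-∣⇒prodₚ-∣ fs-irr fs-distinct fs∣h)

  monic-∣⇒deg≤ : ∀ {f h d n} → HasLeadingTerm f d 1# → HasLeadingTerm h n 1# → f ∣ h → d ≤ n
  monic-∣⇒deg≤ {f} {h} {d} f-leading h-leading (divides r fr≋h) with normalise r
  ... | null r≋[] = contradiction
    (≋[]⇒leadingCoeff≈0 (≋-trans (≋-sym fr≋h) (≋-trans (*ₚ-congˡ f r≋[]) (*ₚ-zeroʳ f))) h-leading) 1#≉0#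
  ... | scaled c g c≉0 r≋cg _ = ≡.subst (d ≤_) d+deg-g≡n (ℕ.m≤m+n d (deg g))
    where
    d+deg-g≡n : d ℕ.+ deg g ≡ _
    d+deg-g≡n = degree-unique c≉0 1#≉0#
      (HasLeadingTerm-resp (≋-trans (*ₚ-congˡ f (≋-sym r≋cg)) fr≋h)
        (HasLeadingTerm-resp-coeff (*-identityˡ c) (HasLeadingTerm-*ₚ f-leading (HasLeadingTerm-scale-monic c g))))
      h-leading

module XⁿMinusOne (R : CommutativeRing 0ℓ 0ℓ) where
  open import Data.Nat.Base as ℕ using (zero; suc; _≤_)
  open import Data.Nat.Primality using (Prime)
  open import Data.List.Base using ([]; [_]; replicate; _++_)
  open CommutativeRing R hiding (zero)
  open Poly R
  open Polynomials R
  open LeadingTerms R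
  open import Algebra.Properties.Semiring.Mult semiring using (_×_)
  open import Algebra.Properties.Semiring.Exp PolynomialRing.semiring using (^-congˡ) renaming (_^_ to _^ₚ_)
  open import Algebra.Properties.Semiring.Mult PolynomialRing.semiring using () renaming (_×_ to _×ₚ_)
  open Frobenius polynomialRing using (frobenius; -1#^p≈-1#)

  xⁿ : ℕ → Pol
  xⁿ n = replicate n 0# ++ [ 1# ]

  xⁿ-1≋xⁿ+[-1] : ∀ n → xⁿ-1 n ≋ (xⁿ n +ₚ [ - 1# ])
  xⁿ-1≋xⁿ+[-1] n = +ₚ-comm [ - 1# ] (xⁿ n)

  xⁿ-*ₚ : ∀ a b → (xⁿ a *ₚ xⁿ b) ≋ xⁿ (a ℕ.+ b)
  xⁿ-*ₚ zero    b = *ₚ-identityˡ (xⁿ b)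
  xⁿ-*ₚ (suc a) b = ≋-trans (0∷-*ₚ (xⁿ a) (xⁿ b)) (∷-cong refl (xⁿ-*ₚ a b))

  xⁿ-^ₚ : ∀ n k → (xⁿ n ^ₚ k) ≋ xⁿ (k ℕ.* n)
  xⁿ-^ₚ n zero    = ≋-refl
  xⁿ-^ₚ n (suc k) = ≋-trans (*ₚ-congˡ (xⁿ n) (xⁿ-^ₚ n k)) (xⁿ-*ₚ n (k ℕ.* n))

  HasLeadingTerm-xⁿ : ∀ n → HasLeadingTerm (xⁿ n) n 1#
  HasLeadingTerm-xⁿ zero    = HasLeadingTerm-[1#]
  HasLeadingTerm-xⁿ (suc n) = HasLeadingTerm-∷ (HasLeadingTerm-xⁿ n)

  HasLeadingTerm-xⁿ-1 : ∀ {n} → 1 ≤ n → HasLeadingTerm (xⁿ-1 n) n 1#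
  HasLeadingTerm-xⁿ-1 {suc n} _ = HasLeadingTerm-∷ (HasLeadingTerm-xⁿ n)

  ×ₚ-[1#] : ∀ n → (n ×ₚ [ 1# ]) ≋ [ n × 1# ]
  ×ₚ-[1#] zero    = ≋-sym (∷-≋-[] refl ≋-refl)
  ×ₚ-[1#] (suc n) = +ₚ-congˡ [ 1# ] (×ₚ-[1#] n)

  module _ {p} (p-prime : Prime p) (char : p × 1# ≈ 0#) where

    charₚ : (p ×ₚ [ 1# ]) ≋ []
    charₚ = ≋-trans (×ₚ-[1#] p) (∷-≋-[] char ≋-refl)

    xⁿ-1-frobenius : ∀ n → xⁿ-1 (p ℕ.* n) ≋ (xⁿ-1 n ^ₚ p)
    xⁿ-1-frobenius n = begin
      xⁿ-1 (p ℕ.* n)                   ≈⟨ xⁿ-1≋xⁿ+[-1] (p ℕ.* n) ⟩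
      xⁿ (p ℕ.* n) +ₚ [ - 1# ]         ≈⟨ +ₚ-cong (xⁿ-^ₚ n p) (-1#^p≈-1# p-prime charₚ) ⟨
      (xⁿ n ^ₚ p) +ₚ ([ - 1# ] ^ₚ p)   ≈⟨ frobenius p-prime charₚ (xⁿ n) [ - 1# ] ⟨
      (xⁿ n +ₚ [ - 1# ]) ^ₚ p          ≈⟨ ^-congˡ p (xⁿ-1≋xⁿ+[-1] n) ⟨
      xⁿ-1 n ^ₚ p                      ∎
      where open ≋-Reasoning

module IrreducibleFactorsOfXⁿ-1 (F : CommutativeRing 0ℓ 0ℓ) (isField : Poly.IsField F)
                                (_≟_ : Decidable (CommutativeRing._≈_ F)) where
  open import Data.Nat.Base as ℕ using (zero; suc; _≤_; _<_)
  import Data.Nat.Properties as ℕ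
  open import Data.Nat.ListAction using (sum)
  open import Algebra.Properties.CommutativeSemigroup ℕ.*-commutativeSemigroup using (x∙yz≈y∙xz)
  open import Data.Nat.Primality using (Prime)
  open import Data.List.Base using (map)
  open import Data.List.Relation.Unary.All as All using (All; []; _∷_)
  open import Data.List.Relation.Unary.AllPairs using (AllPairs)
  open import Data.Product.Base as Product using (proj₁; _,_)
  open import Relation.Binary.PropositionalEquality using (subst)
  open import Relation.Nullary using (¬_)
  open import Relation.Nullary.Decidable using (decidable-stable)
  open CommutativeRing F using (1#; 0#; _≈_; semiring)
  open Poly F
  open Polynomials F
  open PolynomialDivisibility F
  open LeadingTerms F
  open PolynomialsOverField F isField _≟_
  open XⁿMinusOne F
  open import Algebra.Properties.Semiring.Mult semiring using (_×_)
  open import Algebra.Properties.Semiring.Exp PolynomialRing.semiring using () renaming (_^_ to _^ₚ_)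

  ¬¬-All : ∀ {X : Set} {P : X → Set} {xs} → All (λ x → ¬ ¬ P x) xs → ¬ ¬ All P xs
  ¬¬-All []           ¬All = ¬All []
  ¬¬-All (¬¬p ∷ ¬¬ps) ¬All = ¬¬p λ p → ¬¬-All ¬¬ps λ ps → ¬All (p ∷ ps)

  -- Without a decision procedure for divisibility by f, primality of f only yields double-negated
  -- conclusions; they suffice because they are only used to prove decidable inequalities on ℕ.
  irreducible-∣^ₚ⇒¬¬∣ : ∀ {f} → Irreducible f → ∀ {g} n → toPol f ∣ (g ^ₚ n) → ¬ ¬ toPol f ∣ g
  irreducible-∣^ₚ⇒¬¬∣ (_ , f-nonunit , _) zero    (divides r fr≋1) _   = f-nonunit (r , coeff-≈ fr≋1)
  irreducible-∣^ₚ⇒¬¬∣ f-irr               (suc n) f∣ggⁿ            f∤g =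
    irreducible-∣^ₚ⇒¬¬∣ f-irr n (irreducible-∣-*ₚ f-irr f∣ggⁿ f∤g) f∤g

  module Characteristic {p} (p-prime : Prime p) (char : p × 1# ≈ 0#) where

    irreducible-∣xⁿ-1[m*pⁱ]⇒¬¬∣xⁿ-1[m] : ∀ {f} → Irreducible f → ∀ m i →
      toPol f ∣ xⁿ-1 (m ℕ.* p ℕ.^ i) → ¬ ¬ toPol f ∣ xⁿ-1 m
    irreducible-∣xⁿ-1[m*pⁱ]⇒¬¬∣xⁿ-1[m] {f} f-irr m zero    f∣ f∤ =
      f∤ (subst (λ n → toPol f ∣ xⁿ-1 n) (ℕ.*-identityʳ m) f∣)
    irreducible-∣xⁿ-1[m*pⁱ]⇒¬¬∣xⁿ-1[m] {f} f-irr m (suc i) f∣ f∤ =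
      irreducible-∣^ₚ⇒¬¬∣ {f} f-irr p
        (∣-respʳ (xⁿ-1-frobenius p-prime char (m ℕ.* p ℕ.^ i))
          (subst (λ n → toPol f ∣ xⁿ-1 n) (x∙yz≈y∙xz m p (p ℕ.^ i)) f∣))
        λ f∣′ → irreducible-∣xⁿ-1[m*pⁱ]⇒¬¬∣xⁿ-1[m] {f} f-irr m i f∣′ f∤

    sum-deg-distinct-factors≤ : ∀ {m} i → 1 ≤ m → ∀ {fs} →
      All (MonicIrredFactor (xⁿ-1 (m ℕ.* p ℕ.^ i))) fs →
      AllPairs (λ f g → ¬ toPol f ≈ₚ toPol g) fs → sum (map deg fs) ≤ m
    sum-deg-distinct-factors≤ {m} i 1≤m {fs} factors distinct =
      decidable-stable (sum (map deg fs) ℕ.≤? m) λ sum≰m →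
        ¬¬-All (All.map ∣xᵐ-1 factors) λ fs∣xᵐ-1 →
          sum≰m (monic-∣⇒deg≤ (HasLeadingTerm-prodₚ fs) (HasLeadingTerm-xⁿ-1 1≤m)
                  (distinct-irreducibles-∣⇒prodₚ-∣ (All.map proj₁ factors) distinct fs∣xᵐ-1))
      where
      ∣xᵐ-1 : ∀ {f} → MonicIrredFactor (xⁿ-1 (m ℕ.* p ℕ.^ i)) f → ¬ ¬ toPol f ∣ xⁿ-1 m
      ∣xᵐ-1 {f} (f-irr , f∣) = irreducible-∣xⁿ-1[m*pⁱ]⇒¬¬∣xⁿ-1[m] {f} f-irr m i (∣ₚ⇒∣ f∣)

    factor∤prodₚ-small-factors⇒e≤deg : ∀ {m i e Lg} →
      Enumerates (λ g → MonicIrredFactor (xⁿ-1 m) g Product.× deg g < e) Lg →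
      ∀ {f} → MonicIrredFactor (xⁿ-1 (m ℕ.* p ℕ.^ i)) f Product.× ¬ toPol f ∣ₚ prodₚ Lg → e ≤ deg f
    factor∤prodₚ-small-factors⇒e≤deg {m} {i} (_ , _ , complete) {f} ((f-irr , f∣) , f∤Lg) = ℕ.≮⇒≥ λ deg<e →
      irreducible-∣xⁿ-1[m*pⁱ]⇒¬¬∣xⁿ-1[m] {f} f-irr m i (∣ₚ⇒∣ f∣) λ f∣xᵐ-1 →
        f∤Lg (∣⇒∣ₚ (any-≈ₚ⇒∣prodₚ {f} (complete f ((f-irr , ∣⇒∣ₚ f∣xᵐ-1) , deg<e))))

module RationalBounds where
  open import Data.Nat.Base as ℕ using (zero; suc; z≤n)
  import Data.Nat.Properties as ℕ
  open import Data.Integer.Base as ℤ using (+_)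
  import Data.Integer.Properties as ℤ
  open import Data.Rational.Base as ℚ using (ℚ; 0ℚ; 1ℚ; _+_; _*_; _-_; -_; _≤_; _<_; _÷_; 1/_; toℚᵘ)
  import Data.Rational.Properties as ℚ
  open import Data.Rational.Unnormalised.Base as ℚᵘ using (ℚᵘ; mkℚᵘ; *≡*; *≤*; *<*)
  import Data.Rational.Unnormalised.Properties as ℚᵘ
  open import Data.List.Base using (List; []; _∷_; map; length)
  open import Data.List.Relation.Unary.All using (All; []; _∷_)
  open import Data.Product.Base using (Σ; _,_)
  open import Relation.Binary.PropositionalEquality using (_≡_; refl; sym; trans; cong; cong₂)
  open import Data.Rational.Solver using (module +-*-Solver)
  open +-*-Solver using (solve; _:=_; _:+_; _:-_; _:*_; con)
  open NaturalNumberFacts using (cross-multiplied-bound)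

  private
    ℕtoℚᵘ : ℕ → ℚᵘ
    ℕtoℚᵘ n = mkℚᵘ (+ n) 0

    toℚᵘ-ℕtoℚ : ∀ n → toℚᵘ (ℕtoℚ n) ℚᵘ.≃ ℕtoℚᵘ n
    toℚᵘ-ℕtoℚ n = ℚ.toℚᵘ-fromℚᵘ (ℕtoℚᵘ n)

  ℕtoℚ-homo-+ : ∀ a b → ℕtoℚ (a ℕ.+ b) ≡ ℕtoℚ a + ℕtoℚ b
  ℕtoℚ-homo-+ a b = ℚ.toℚᵘ-injective (ℚᵘ.≃-trans (toℚᵘ-ℕtoℚ (a ℕ.+ b)) (ℚᵘ.≃-trans
    (*≡* (trans (cong (ℤ._* + 1) (ℤ.pos-+ a b))
                (cong₂ (λ x y → (x ℤ.+ y) ℤ.* + 1) (sym (ℤ.*-identityʳ (+ a))) (sym (ℤ.*-identityʳ (+ b))))))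
    (ℚᵘ.≃-sym (ℚᵘ.≃-trans (ℚ.toℚᵘ-homo-+ (ℕtoℚ a) (ℕtoℚ b)) (ℚᵘ.+-cong (toℚᵘ-ℕtoℚ a) (toℚᵘ-ℕtoℚ b))))))

  ℕtoℚ-homo-* : ∀ a b → ℕtoℚ (a ℕ.* b) ≡ ℕtoℚ a * ℕtoℚ b
  ℕtoℚ-homo-* a b = ℚ.toℚᵘ-injective (ℚᵘ.≃-trans (toℚᵘ-ℕtoℚ (a ℕ.* b)) (ℚᵘ.≃-trans
    (*≡* (cong (ℤ._* + 1) (ℤ.pos-* a b)))
    (ℚᵘ.≃-sym (ℚᵘ.≃-trans (ℚ.toℚᵘ-homo-* (ℕtoℚ a) (ℕtoℚ b)) (ℚᵘ.*-cong (toℚᵘ-ℕtoℚ a) (toℚᵘ-ℕtoℚ b))))))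

  ℕtoℚ-homo-*³ : ∀ a b c → ℕtoℚ (a ℕ.* b ℕ.* c) ≡ ℕtoℚ a * ℕtoℚ b * ℕtoℚ c
  ℕtoℚ-homo-*³ a b c = trans (ℕtoℚ-homo-* (a ℕ.* b) c) (cong (_* ℕtoℚ c) (ℕtoℚ-homo-* a b))

  ℕtoℚ-mono-≤ : ∀ {a b} → a ℕ.≤ b → ℕtoℚ a ≤ ℕtoℚ b
  ℕtoℚ-mono-≤ {a} {b} a≤b = ℚ.toℚᵘ-cancel-≤ (ℚᵘ.≤-respˡ-≃ (ℚᵘ.≃-sym (toℚᵘ-ℕtoℚ a))
    (ℚᵘ.≤-respʳ-≃ (ℚᵘ.≃-sym (toℚᵘ-ℕtoℚ b)) (*≤* (ℤ.*-monoʳ-≤-nonNeg (+ 1) (ℤ.+≤+ a≤b)))))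

  ℕtoℚ-mono-< : ∀ {a b} → a ℕ.< b → ℕtoℚ a < ℕtoℚ b
  ℕtoℚ-mono-< {a} {b} a<b = ℚ.toℚᵘ-cancel-< (ℚᵘ.<-respˡ-≃ (ℚᵘ.≃-sym (toℚᵘ-ℕtoℚ a))
    (ℚᵘ.<-respʳ-≃ (ℚᵘ.≃-sym (toℚᵘ-ℕtoℚ b)) (*<* (ℤ.*-monoʳ-<-pos (+ 1) (ℤ.+<+ a<b)))))

  ℕtoℚ[1+n]*recip[1+n]≡1 : ∀ n → ℕtoℚ (suc n) * recip (suc n) ≡ 1ℚ
  ℕtoℚ[1+n]*recip[1+n]≡1 n = ℚ.toℚᵘ-injective (ℚᵘ.≃-trans (ℚ.toℚᵘ-homo-* (ℕtoℚ (suc n)) (recip (suc n)))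
    (ℚᵘ.≃-trans (ℚᵘ.*-cong (toℚᵘ-ℕtoℚ (suc n)) (ℚ.toℚᵘ-fromℚᵘ (mkℚᵘ (+ 1) n)))
                (ℚᵘ.*-inverseʳ (ℕtoℚᵘ (suc n)))))

  ℕtoℚ*recip≤1 : ∀ {a n} → a ℕ.≤ n → ℕtoℚ a * recip n ≤ 1ℚ
  ℕtoℚ*recip≤1 {a} {zero}  _   = ℚ.≤-trans (ℚ.≤-reflexive (ℚ.*-zeroʳ (ℕtoℚ a))) (ℚ.<⇒≤ (ℚ.positive⁻¹ 1ℚ))
  ℕtoℚ*recip≤1 {a} {suc n} a≤n = ℚ.≤-trans
    (ℚ.*-monoʳ-≤-nonNeg (recip (suc n)) {{ℚ.normalize-nonNeg 1 (suc n)}} (ℕtoℚ-mono-≤ a≤n))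
    (ℚ.≤-reflexive (ℕtoℚ[1+n]*recip[1+n]≡1 n))

  q^e*sum-recip≤length : ∀ q e .{{_ : ℕ.NonZero q}} (ds : List ℕ) → All (e ℕ.≤_) ds →
    ℕtoℚ (q ℕ.^ e) * sumℚ (map (λ d → recip (q ℕ.^ d)) ds) ≤ ℕtoℚ (length ds)
  q^e*sum-recip≤length q e []       []         = ℚ.≤-reflexive (ℚ.*-zeroʳ (ℕtoℚ (q ℕ.^ e)))
  q^e*sum-recip≤length q e (d ∷ ds) (e≤d ∷ es) = begin
    Q * (recip (q ℕ.^ d) + S)     ≡⟨ ℚ.*-distribˡ-+ Q (recip (q ℕ.^ d)) S ⟩
    Q * recip (q ℕ.^ d) + Q * S   ≤⟨ ℚ.+-mono-≤ (ℕtoℚ*recip≤1 (ℕ.^-monoʳ-≤ q e≤d)) (q^e*sum-recip≤length q e ds es) ⟩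
    1ℚ + ℕtoℚ (length ds)         ≡⟨ ℕtoℚ-homo-+ 1 (length ds) ⟨
    ℕtoℚ (suc (length ds))        ∎
    where
    open ℚ.≤-Reasoning
    Q = ℕtoℚ (q ℕ.^ e)
    S = sumℚ (map (λ d → recip (q ℕ.^ d)) ds)

  [2t-1]Q≤[2m-2][Q-2t] : ∀ {t m Q} → 1 ℕ.≤ m → 3 ℕ.* t ℕ.≤ m → m ℕ.< Q →
    ℕtoℚ Q * (ℕtoℚ (2 ℕ.* t) - 1ℚ) ≤ (ℕtoℚ (2 ℕ.* m) - ℕtoℚ 2) * (ℕtoℚ Q - ℕtoℚ 2 * ℕtoℚ t)
  [2t-1]Q≤[2m-2][Q-2t] {t} {m} {Q} 1≤m 3t≤m m<Q = begin
    Q̂ * (ℕtoℚ (2 ℕ.* t) - 1ℚ)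
      ≡⟨ cong (λ y → Q̂ * (y - 1ℚ)) (ℕtoℚ-homo-* 2 t) ⟩
    Q̂ * (two * T - 1ℚ)
      ≡⟨ solve 3 (λ Q T M → Q :* (con two :* T :- con 1ℚ)
                            := (con two :* T :* Q :+ Q :+ con four :* M :* T) :- (con two :* Q :+ con four :* M :* T))
               refl Q̂ T M ⟩
    (two * T * Q̂ + Q̂ + four * M * T) - C
      ≡⟨ cong (_- C) lhs-cast ⟨
    ℕtoℚ (2 ℕ.* t ℕ.* Q ℕ.+ Q ℕ.+ 4 ℕ.* m ℕ.* t) - C
      ≤⟨ ℚ.+-monoˡ-≤ (- C) (ℕtoℚ-mono-≤ (cross-multiplied-bound {t} {m} {Q} 1≤m 3t≤m m<Q)) ⟩
    ℕtoℚ (2 ℕ.* m ℕ.* Q ℕ.+ 4 ℕ.* t) - C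
      ≡⟨ cong (_- C) rhs-cast ⟩
    (two * M * Q̂ + four * T) - C
      ≡⟨ solve 3 (λ Q T M → (con two :* M :* Q :+ con four :* T) :- (con two :* Q :+ con four :* M :* T)
                            := (con two :* M :- con two) :* (Q :- con two :* T))
               refl Q̂ T M ⟩
    (two * M - two) * (Q̂ - two * T)
      ≡⟨ cong (λ y → (y - two) * (Q̂ - two * T)) (ℕtoℚ-homo-* 2 m) ⟨
    (ℕtoℚ (2 ℕ.* m) - two) * (Q̂ - two * T) ∎
    where
    open ℚ.≤-Reasoning
    T M Q̂ two four C : ℚ
    T = ℕtoℚ t
    M = ℕtoℚ m
    Q̂ = ℕtoℚ Q
    two = ℕtoℚ 2
    four = ℕtoℚ 4
    C = two * Q̂ + four * M * T
    lhs-cast : ℕtoℚ (2 ℕ.* t ℕ.* Q ℕ.+ Q ℕ.+ 4 ℕ.* m ℕ.* t) ≡ two * T * Q̂ + Q̂ + four * M * T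
    lhs-cast = trans (ℕtoℚ-homo-+ (2 ℕ.* t ℕ.* Q ℕ.+ Q) (4 ℕ.* m ℕ.* t)) (cong₂ _+_
      (trans (ℕtoℚ-homo-+ (2 ℕ.* t ℕ.* Q) Q) (cong (_+ Q̂) (ℕtoℚ-homo-*³ 2 t Q))) (ℕtoℚ-homo-*³ 4 m t))
    rhs-cast : ℕtoℚ (2 ℕ.* m ℕ.* Q ℕ.+ 4 ℕ.* t) ≡ two * M * Q̂ + four * T
    rhs-cast = trans (ℕtoℚ-homo-+ (2 ℕ.* m ℕ.* Q) (4 ℕ.* t)) (cong₂ _+_ (ℕtoℚ-homo-*³ 2 m Q) (ℕtoℚ-homo-* 4 t))

  module _ {t Q : ℕ} (s : ℚ) (Qs≤t : ℕtoℚ Q * s ≤ ℕtoℚ t) where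
    open ℚ.≤-Reasoning

    Q-2t≤Q[1-2s] : ℕtoℚ Q - ℕtoℚ 2 * ℕtoℚ t ≤ ℕtoℚ Q * (1ℚ - ℕtoℚ 2 * s)
    Q-2t≤Q[1-2s] = begin
      ℕtoℚ Q - ℕtoℚ 2 * ℕtoℚ t        ≤⟨ ℚ.+-monoʳ-≤ (ℕtoℚ Q) (ℚ.neg-antimono-≤ (ℚ.*-monoˡ-≤-nonNeg (ℕtoℚ 2) Qs≤t)) ⟩
      ℕtoℚ Q - ℕtoℚ 2 * (ℕtoℚ Q * s)  ≡⟨ solve 2 (λ Q s → Q :- con (ℕtoℚ 2) :* (Q :* s) := Q :* (con 1ℚ :- con (ℕtoℚ 2) :* s))
                                                refl (ℕtoℚ Q) s ⟩
      ℕtoℚ Q * (1ℚ - ℕtoℚ 2 * s)      ∎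

    1-2s>0 : 2 ℕ.* t ℕ.< Q → 0ℚ < 1ℚ - ℕtoℚ 2 * s
    1-2s>0 2t<Q = ℚ.*-cancelˡ-<-nonNeg (ℕtoℚ Q) {{ℚ.nonNegative (ℕtoℚ-mono-≤ {0} {Q} z≤n)}} (begin-strict
      ℕtoℚ Q * 0ℚ                             ≡⟨ ℚ.*-zeroʳ (ℕtoℚ Q) ⟩
      0ℚ                                      ≡⟨ ℚ.+-inverseʳ (ℕtoℚ 2 * ℕtoℚ t) ⟨
      ℕtoℚ 2 * ℕtoℚ t - ℕtoℚ 2 * ℕtoℚ t       ≡⟨ cong (_- ℕtoℚ 2 * ℕtoℚ t) (ℕtoℚ-homo-* 2 t) ⟨
      ℕtoℚ (2 ℕ.* t) - ℕtoℚ 2 * ℕtoℚ t        <⟨ ℚ.+-monoˡ-< (- (ℕtoℚ 2 * ℕtoℚ t)) (ℕtoℚ-mono-< 2t<Q) ⟩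
      ℕtoℚ Q - ℕtoℚ 2 * ℕtoℚ t                ≤⟨ Q-2t≤Q[1-2s] ⟩
      ℕtoℚ Q * (1ℚ - ℕtoℚ 2 * s)              ∎)

  𝒮-bound : ∀ {t m Q} (s : ℚ) → 1 ℕ.≤ m → 3 ℕ.* t ℕ.≤ m → m ℕ.< Q → ℕtoℚ Q * s ≤ ℕtoℚ t →
            Σ (0ℚ < 1ℚ - ℕtoℚ 2 * s) λ 𝒟>0 → 𝒮 t (1ℚ - ℕtoℚ 2 * s) 𝒟>0 ≤ ℕtoℚ (2 ℕ.* m)
  𝒮-bound {t} {m} {Q} s 1≤m 3t≤m m<Q Qs≤t = D>0 , 𝒮≤2m
    where
    open ℚ.≤-Reasoning
    D x W : ℚ
    D = 1ℚ - ℕtoℚ 2 * s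
    x = ℕtoℚ (2 ℕ.* t) - 1ℚ
    W = ℕtoℚ (2 ℕ.* m) - ℕtoℚ 2

    D>0 : 0ℚ < D
    D>0 = 1-2s>0 {t} {Q} s Qs≤t (ℕ.≤-<-trans (ℕ.≤-trans (ℕ.*-monoˡ-≤ t (ℕ.n≤1+n 2)) 3t≤m) m<Q)

    W≥0 : 0ℚ ≤ W
    W≥0 = begin
      0ℚ                   ≡⟨ ℚ.+-inverseʳ (ℕtoℚ 2) ⟨
      ℕtoℚ 2 - ℕtoℚ 2      ≤⟨ ℚ.+-monoˡ-≤ (- ℕtoℚ 2) (ℕtoℚ-mono-≤ (ℕ.*-monoʳ-≤ 2 1≤m)) ⟩
      W                    ∎

    x≤WD : x ≤ W * D
    x≤WD = ℚ.*-cancelˡ-≤-pos (ℕtoℚ Q) {{ℚ.positive (ℕtoℚ-mono-< {0} {Q} (ℕ.≤-<-trans z≤n m<Q))}} (begin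
      ℕtoℚ Q * x                          ≤⟨ [2t-1]Q≤[2m-2][Q-2t] {t} {m} {Q} 1≤m 3t≤m m<Q ⟩
      W * (ℕtoℚ Q - ℕtoℚ 2 * ℕtoℚ t)      ≤⟨ ℚ.*-monoˡ-≤-nonNeg W {{ℚ.nonNegative W≥0}} (Q-2t≤Q[1-2s] {t} {Q} s Qs≤t) ⟩
      W * (ℕtoℚ Q * D)                    ≡⟨ solve 3 (λ W Q D → W :* (Q :* D) := Q :* (W :* D)) refl W (ℕtoℚ Q) D ⟩
      ℕtoℚ Q * (W * D)                    ∎)

    instance
      D-positive : ℚ.Positive D
      D-positive = ℚ.positive D>0

      D-nonZero : ℚ.NonZero D
      D-nonZero = ℚ.pos⇒nonZero D

    𝒮≤2m : x ÷ D + ℕtoℚ 2 ≤ ℕtoℚ (2 ℕ.* m)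
    𝒮≤2m = begin
      x * 1/ D + ℕtoℚ 2       ≤⟨ ℚ.+-monoˡ-≤ (ℕtoℚ 2) (ℚ.*-monoʳ-≤-nonNeg (1/ D) {{1/D≥0}} x≤WD) ⟩
      W * D * 1/ D + ℕtoℚ 2   ≡⟨ cong (_+ ℕtoℚ 2) (trans (ℚ.*-assoc W D (1/ D))
                                   (trans (cong (W *_) (ℚ.*-inverseʳ D)) (ℚ.*-identityʳ W))) ⟩
      W + ℕtoℚ 2              ≡⟨ solve 2 (λ n tw → n :- tw :+ tw := n) refl (ℕtoℚ (2 ℕ.* m)) (ℕtoℚ 2) ⟩
      ℕtoℚ (2 ℕ.* m)          ∎
      where
      1/D≥0 : ℚ.NonNegative (1/ D)
      1/D≥0 = ℚ.nonNegative (ℚ.<⇒≤ (ℚ.positive⁻¹ (1/ D) {{ℚ.1/pos⇒pos D}}))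

open import Data.Nat.Base using (_*_; _^_; _∸_; _<_)
open import Data.Nat.Divisibility using (_∣_)
open import Data.Nat.Primality using (Prime)
open import Data.Nat.Coprimality using (Coprime)
open import Data.Rational as ℚ using (0ℚ)
open import Data.List using (List; length; map)
open import Data.Product using (Σ; _×_)
open import Relation.Nullary using (¬_)

open import Data.Nat.Base using (_≤_; s≤s; z≤n; >-nonZero)
import Data.Nat.Properties as ℕ
open import Data.Nat.ListAction using (sum)
open import Data.List.Properties using (length-map)
open import Data.List.Relation.Unary.All as All using (All)
open import Data.List.Relation.Unary.All.Properties using (map⁺)
open import Data.Product using (proj₁; _,_)
open import Relation.Binary.PropositionalEquality using (refl; subst)
open NaturalNumberFacts
open RationalBounds using (𝒮-bound; q^e*sum-recip≤length)

lemma5p3 : (p k m i e : ℕ) → Prime p → Coprime m p → ¬ (m ∣ (p ^ k ∸ 1)) →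
    IsMulOrder (p ^ k) m e → 2 < e →
    (F : CommutativeRing 0ℓ 0ℓ) → Poly.IsField F → Poly.HasSize F (p ^ k) →
    (Lg : List (Poly.Monic F)) →
    Poly.Enumerates F (λ f → Poly.MonicIrredFactor F (Poly.xⁿ-1 F m) f × Poly.deg F f < e) Lg →
    (L : List (Poly.Monic F)) →
    Poly.Enumerates F (λ f → Poly.MonicIrredFactor F (Poly.xⁿ-1 F (m * p ^ i)) f × ¬ (Poly._∣ₚ_ F (Poly.toPol F f) (Poly.prodₚ F Lg))) L →
    Σ (0ℚ ℚ.< 𝒟 (p ^ k) (map (Poly.deg F) L)) λ h →
      𝒮 (length L) (𝒟 (p ^ k) (map (Poly.deg F) L)) h ℚ.≤ ℕtoℚ (2 * m)
lemma5p3 p k m i e p-prime m⊥p m∤q-1 (_ , m∣qᵉ-1 , _) 2<e F isField size Lg small-factors L (factors , distinct , _) =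
  𝒮-bound {length L} {m} {q ^ e} s 1≤m 3t≤m m<qᵉ qᵉs≤t
  where
  open Poly F using (deg)
  open FiniteCommutativeRing F size using (_≟_)
  open IrreducibleFactorsOfXⁿ-1 F isField _≟_
  open Characteristic p-prime (FiniteField.characteristic F isField size {p} {k} refl)

  q : ℕ
  q = p ^ k

  degrees : List ℕ
  degrees = map deg L

  s : ℚ.ℚ
  s = sumℚ (map (λ d → recip (q ^ d)) degrees)

  1≤m : 1 ≤ m
  1≤m = coprimeTo-prime⇒>0 p-prime m⊥p

  2≤q : 2 ≤ q
  2≤q = ∤pᵏ∸1⇒2≤pᵏ {p} {k} p-prime m∤q-1

  m<qᵉ : m < q ^ e
  m<qᵉ = ∣n∸1⇒< (2≤a^n 2≤q (ℕ.≤-trans (s≤s z≤n) 2<e)) m∣qᵉ-1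

  e≤degrees : All (e ≤_) degrees
  e≤degrees = map⁺ (All.map (λ {f} → factor∤prodₚ-small-factors⇒e≤deg {m} {i} small-factors {f}) factors)

  sum≤m : sum degrees ≤ m
  sum≤m = sum-deg-distinct-factors≤ i 1≤m (All.map proj₁ factors) distinct

  3t≤m : 3 * length L ≤ m
  3t≤m = subst (λ t → 3 * t ≤ m) (length-map deg L) (ℕ.≤-trans (3*length≤sum degrees 2<e e≤degrees) sum≤m)

  qᵉs≤t : ℕtoℚ (q ^ e) ℚ.* s ℚ.≤ ℕtoℚ (length L)
  qᵉs≤t = subst (λ t → ℕtoℚ (q ^ e) ℚ.* s ℚ.≤ ℕtoℚ t) (length-map deg L)
            (q^e*sum-recip≤length q e {{>-nonZero (ℕ.≤-trans (s≤s z≤n) 2≤q)}} degrees e≤degrees)
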